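{- Let $l$ be a prime, let $\{C_i\}_{i\ge 1}$ be a countable family of finite cyclic abelian $l$-groups whose orders are unbounded as $i\to\infty$, and let $A$ be a finite abelian $l$-group. Then, up to isomorphism, there exists exactly one torsion abelian $l$-group $B$ satisfying both: (1) there is an exact sequence $1\to A\to B\to \bigoplus_{i\ge1}C_i\to 1$; (2) (the image of) $A$ equals $\bigcap_{n\ge1} nB$, the set of all divisible elements of $B$. -}

module Defs where

open import Level using (Level; _⊔_)
open import Data.Nat using (ℕ; zero; suc; _≤_; _<_; _^_) renaming (_⊔_ to _⊔ℕ_)
open import Data.Nat.Properties using (m≤m⊔n; m≤n⊔m; ≤-trans)
open import Data.Fin using (Fin)
open import Data.Product using (Σ; ∃; _×_; _,_; proj₁; proj₂)
open import Data.Sum using (_⊎_)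
open import Relation.Binary.PropositionalEquality using (_≡_)
open import Algebra.Bundles using (AbelianGroup)
open import Algebra.Structures using (IsAbelianGroup)
import Algebra.Properties.Group as GP
open import Algebra.Morphism.Structures using (module GroupMorphisms)
open import Function.Definitions using (Surjective)

module _ {c ℓ : Level} (G : AbelianGroup c ℓ) where
  open AbelianGroup G

  pow : ℕ → Carrier → Carrier
  pow zero    x = ε
  pow (suc n) x = x ∙ pow n x

  IsTorsionLGroup : ℕ → Set (c ⊔ ℓ)
  IsTorsionLGroup l = ∀ x → ∃ λ k → pow (l ^ k) x ≈ ε

  HasCard : ℕ → Set (c ⊔ ℓ)
  HasCard m = Σ (Fin m → Carrier) λ f →
                (∀ i j → f i ≈ f j → i ≡ j) × (∀ x → ∃ λ i → f i ≈ x)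

  IsFinite : Set (c ⊔ ℓ)
  IsFinite = ∃ λ m → HasCard m

  IsCyclic : Set (c ⊔ ℓ)
  IsCyclic = ∃ λ g → ∀ x → ∃ λ n → (pow n g ≈ x) ⊎ (pow n g ⁻¹ ≈ x)

  IsDivisibleElt : Carrier → Set (c ⊔ ℓ)
  IsDivisibleElt x = ∀ n → 1 ≤ n → ∃ λ y → pow n y ≈ x

module DirectSum {c ℓ : Level} (C : ℕ → AbelianGroup c ℓ) where
  module C i = AbelianGroup (C i)

  record Elt : Set (c ⊔ ℓ) where
    constructor mkElt
    field
      fn    : (i : ℕ) → C.Carrier i
      bound : ℕ
      supp  : ∀ i → bound ≤ i → C._≈_ i (fn i) (C.ε i)
  open Elt public

  _≋_ : Elt → Elt → Set ℓ
  x ≋ y = ∀ i → C._≈_ i (fn x i) (fn y i)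

  _+_ : Elt → Elt → Elt
  x + y = mkElt (λ i → C._∙_ i (fn x i) (fn y i)) (bound x ⊔ℕ bound y)
    (λ i b≤i → C.trans i (C.∙-cong i (supp x i (≤-trans (m≤m⊔n _ _) b≤i))
                                     (supp y i (≤-trans (m≤n⊔m _ _) b≤i)))
                         (C.identityˡ i (C.ε i)))

  0# : Elt
  0# = mkElt (λ i → C.ε i) 0 (λ i _ → C.refl i)

  -_ : Elt → Elt
  - x = mkElt (λ i → C._⁻¹ i (fn x i)) (bound x)
    (λ i b≤i → C.trans i (C.⁻¹-cong i (supp x i b≤i)) (GP.ε⁻¹≈ε (C.group i)))

  isAbelianGroup : IsAbelianGroup _≋_ _+_ 0# -_
  isAbelianGroup = record
    { isGroup = record
      { isMonoid = record
        { isSemigroup = record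
          { isMagma = record
            { isEquivalence = record
              { refl  = λ i → C.refl i
              ; sym   = λ p i → C.sym i (p i)
              ; trans = λ p q i → C.trans i (p i) (q i) }
            ; ∙-cong = λ p q i → C.∙-cong i (p i) (q i) }
          ; assoc = λ x y z i → C.assoc i (fn x i) (fn y i) (fn z i) }
        ; identity = (λ x i → C.identityˡ i (fn x i))
                   , (λ x i → C.identityʳ i (fn x i)) }
      ; inverse = (λ x i → C.inverseˡ i (fn x i))
                , (λ x i → C.inverseʳ i (fn x i))
      ; ⁻¹-cong = λ p i → C.⁻¹-cong i (p i) }
    ; comm = λ x y i → C.comm i (fn x i) (fn y i) }

⨁ : {c ℓ : Level} → (ℕ → AbelianGroup c ℓ) → AbelianGroup (c ⊔ ℓ) ℓ
⨁ C = record { isAbelianGroup = DirectSum.isAbelianGroup C }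

module _ {a ℓa b ℓb : Level} (G : AbelianGroup a ℓa) (H : AbelianGroup b ℓb) where
  private
    module G = AbelianGroup G
    module H = AbelianGroup H
  open GroupMorphisms G.rawGroup H.rawGroup

  IsHom : (G.Carrier → H.Carrier) → Set (a ⊔ ℓa ⊔ ℓb)
  IsHom = IsGroupHomomorphism

  IsMono : (G.Carrier → H.Carrier) → Set (a ⊔ ℓa ⊔ ℓb)
  IsMono = IsGroupMonomorphism

  Isomorphic : Set (a ⊔ b ⊔ ℓa ⊔ ℓb)
  Isomorphic = Σ (G.Carrier → H.Carrier) IsGroupIsomorphism

record IsSolution {a ℓa c ℓc b ℓb : Level} (l : ℕ)
                  (A : AbelianGroup a ℓa) (C : ℕ → AbelianGroup c ℓc)
                  (B : AbelianGroup b ℓb) : Set (a ⊔ ℓa ⊔ c ⊔ ℓc ⊔ b ⊔ ℓb) where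
  private
    module A = AbelianGroup A
    module B = AbelianGroup B
    module D = AbelianGroup (⨁ C)
  field
    torsion-l : IsTorsionLGroup B l
    ι         : A.Carrier → B.Carrier
    π         : B.Carrier → D.Carrier
    ι-mono    : IsMono A B ι
    π-hom     : IsHom B (⨁ C) π
    π-surj    : Surjective B._≈_ D._≈_ π
    exact     : ∀ x → (D._≈_ (π x) D.ε → ∃ λ y → B._≈_ (ι y) x)
                    × ((∃ λ y → B._≈_ (ι y) x) → D._≈_ (π x) D.ε)
    divisible : ∀ x → ((∃ λ y → B._≈_ (ι y) x) → IsDivisibleElt B x)
                    × (IsDivisibleElt B x → ∃ λ y → B._≈_ (ι y) x)

-- Lift the generator g i of C i ≅ ℤ / l ^ n i to b i ∈ B; then l ^ n i · b i = α i lies in A and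
-- B is the presented group ⟨ A, e₀, e₁, … ∣ l ^ n i · e i = α i ⟩.  Divisibility of A inside B
-- says that every element of A is a combination of α j's with n j arbitrarily large.  For two
-- such families α and β, relations can be traded: if α i = Σ E i j · α j with n i ≤ n j, then
-- e i ↦ e i + Σ l ^ (n j − n i) E i j · e j identifies the presentation by α with the one where
-- α i is replaced by 0.  Cutting the exponents into alternating blocks and exchanging α for β
-- block by block gives B₁ ≅ B₂.  A solution exists: take α₀ enumerating every element of A
-- infinitely often along indices of increasing exponent.

module Submission where

open import Defs
open import Level using (Level; _⊔_; Lift; lift)
open import Data.Unit using (⊤; tt)
open import Data.Empty using (⊥-elim)
open import Data.Bool using (Bool; true; false; if_then_else_; not)
open import Data.Nat as ℕ using (ℕ; zero; suc; _≤_; _<_; z≤n; s≤s; _^_; _+_; _*_; _∸_; NonZero; _/_) renaming (_⊔_ to _⊔ℕ_)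
import Data.Nat.Properties as ℕP
open import Data.Nat.Induction using (<-rec)
open import Data.Nat.DivMod using (m%n<n; m/n*n≡m; 0/n≡0; [m+kn]%n≡m%n; m<n⇒m%n≡m)
open import Data.Nat.Divisibility using (_∣_; divides; _∣?_; *-cancelˡ-∣; ∣1⇒≡1; ∣⇒≤)
open import Data.Nat.Coprimality using (Coprime; coprime-divisor)
open import Data.Nat.GCD using (gcd; gcd-GCD; gcd[m,n]∣m; gcd[m,n]∣n; module Bézout)
open import Data.Nat.Primality using (Prime; prime⇒irreducible)
open import Data.Integer as ℤ using (ℤ; +_; -[1+_]; 0ℤ; _⊖_; _%ℕ_; _/ℕ_)
open import Data.Integer.DivMod using (n%ℕd<d; a≡a%ℕn+[a/ℕn]*n)
import Data.Integer.Properties as ℤP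
open import Data.Integer.Tactic.RingSolver using (solve-∀)
open import Data.Fin as Fin using (Fin; toℕ; fromℕ<)
import Data.Fin.Properties as FinP
open import Data.Product using (Σ; ∃; _×_; _,_; proj₁; proj₂)
open import Data.Sum using (_⊎_; inj₁; inj₂)
open import Relation.Nullary using (¬_; Dec; yes; no)
open import Relation.Binary using (tri<; tri≈; tri>)
open import Relation.Binary.PropositionalEquality as Eq using (_≡_)
open import Algebra.Bundles using (AbelianGroup)
open import Algebra.Structures using (IsAbelianGroup)
open import Algebra.Morphism.Structures using (module GroupMorphisms)
import Algebra.Properties.Group as GroupProperties
import Algebra.Properties.AbelianGroup as AbelianGroupProperties
import Algebra.Properties.CommutativeSemigroup as CommutativeSemigroupProperties
import Relation.Binary.Reasoning.Setoid as SetoidReasoning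

-- Integer multiples and finite sums in an abelian group

module Powers {c ℓ : Level} (G : AbelianGroup c ℓ) where
  open AbelianGroup G
  open SetoidReasoning setoid
  open GroupProperties group public
    using (ε⁻¹≈ε; ⁻¹-involutive; inverseʳ-unique; x∙y⁻¹≈ε⇒x≈y)
  open AbelianGroupProperties G public using (⁻¹-∙-comm)
  open CommutativeSemigroupProperties commutativeSemigroup public using (interchange)

  infixr 8 _·_ _·ℤ_

  _·_ : ℕ → Carrier → Carrier
  n · x = pow G n x

  ·-cong : ∀ n {x y} → x ≈ y → n · x ≈ n · y
  ·-cong zero    p = refl
  ·-cong (suc n) p = ∙-cong p (·-cong n p)

  ·-distribʳ-+ : ∀ m n x → (m + n) · x ≈ m · x ∙ n · x
  ·-distribʳ-+ zero    n x = sym (identityˡ _)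
  ·-distribʳ-+ (suc m) n x = begin
    x ∙ (m + n) · x     ≈⟨ ∙-cong refl (·-distribʳ-+ m n x) ⟩
    x ∙ (m · x ∙ n · x) ≈⟨ sym (assoc _ _ _) ⟩
    suc m · x ∙ n · x   ∎

  ·-ε : ∀ n → n · ε ≈ ε
  ·-ε zero    = refl
  ·-ε (suc n) = trans (∙-cong refl (·-ε n)) (identityˡ ε)

  ·-distribˡ-∙ : ∀ n x y → n · (x ∙ y) ≈ n · x ∙ n · y
  ·-distribˡ-∙ zero    x y = sym (identityˡ ε)
  ·-distribˡ-∙ (suc n) x y = begin
    (x ∙ y) ∙ n · (x ∙ y)     ≈⟨ ∙-cong refl (·-distribˡ-∙ n x y) ⟩
    (x ∙ y) ∙ (n · x ∙ n · y) ≈⟨ interchange _ _ _ _ ⟩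
    suc n · x ∙ suc n · y     ∎

  ·-⁻¹ : ∀ n x → n · (x ⁻¹) ≈ (n · x) ⁻¹
  ·-⁻¹ zero    x = sym ε⁻¹≈ε
  ·-⁻¹ (suc n) x = trans (∙-cong refl (·-⁻¹ n x)) (⁻¹-∙-comm _ _)

  ·-assoc : ∀ m n x → (m * n) · x ≈ m · n · x
  ·-assoc zero    n x = refl
  ·-assoc (suc m) n x = begin
    (n + m * n) · x   ≈⟨ ·-distribʳ-+ n (m * n) x ⟩
    n · x ∙ (m * n) · x ≈⟨ ∙-cong refl (·-assoc m n x) ⟩
    n · x ∙ m · n · x   ∎

  ·-comm : ∀ m n x → m · n · x ≈ n · m · x
  ·-comm m n x = begin
    m · n · x   ≈⟨ sym (·-assoc m n x) ⟩
    (m * n) · x ≡⟨ Eq.cong (_· x) (ℕP.*-comm m n) ⟩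
    (n * m) · x ≈⟨ ·-assoc n m x ⟩
    n · m · x   ∎

  _·ℤ_ : ℤ → Carrier → Carrier
  (+ n)    ·ℤ x = n · x
  -[1+ n ] ·ℤ x = (suc n · x) ⁻¹

  ·ℤ-cong : ∀ z {x y} → x ≈ y → z ·ℤ x ≈ z ·ℤ y
  ·ℤ-cong (+ n)      p = ·-cong n p
  ·ℤ-cong (-[1+ n ]) p = ⁻¹-cong (·-cong (suc n) p)

  ·ℤ-ε : ∀ z → z ·ℤ ε ≈ ε
  ·ℤ-ε (+ n)      = ·-ε n
  ·ℤ-ε (-[1+ n ]) = trans (⁻¹-cong (·-ε (suc n))) ε⁻¹≈ε

  ·ℤ-identityˡ : ∀ x → (+ 1) ·ℤ x ≈ x
  ·ℤ-identityˡ = identityʳ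

  ·ℤ-distribˡ-∙ : ∀ z x y → z ·ℤ (x ∙ y) ≈ z ·ℤ x ∙ z ·ℤ y
  ·ℤ-distribˡ-∙ (+ n)      x y = ·-distribˡ-∙ n x y
  ·ℤ-distribˡ-∙ (-[1+ n ]) x y =
    trans (⁻¹-cong (·-distribˡ-∙ (suc n) x y)) (sym (⁻¹-∙-comm _ _))

  ·ℤ-⁻¹ : ∀ z x → z ·ℤ (x ⁻¹) ≈ (z ·ℤ x) ⁻¹
  ·ℤ-⁻¹ (+ n)      x = ·-⁻¹ n x
  ·ℤ-⁻¹ (-[1+ n ]) x = ⁻¹-cong (·-⁻¹ (suc n) x)

  ·ℤ-neg : ∀ z x → (ℤ.- z) ·ℤ x ≈ (z ·ℤ x) ⁻¹
  ·ℤ-neg (+ zero)   x = sym ε⁻¹≈ε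
  ·ℤ-neg (+ suc n)  x = refl
  ·ℤ-neg (-[1+ n ]) x = sym (⁻¹-involutive _)

  ·ℤ-⊖ : ∀ m n x → (m ⊖ n) ·ℤ x ≈ m · x ∙ (n · x) ⁻¹
  ·ℤ-⊖ zero    zero    x = sym (trans (identityˡ _) ε⁻¹≈ε)
  ·ℤ-⊖ zero    (suc n) x = sym (identityˡ _)
  ·ℤ-⊖ (suc m) zero    x = sym (trans (∙-cong refl ε⁻¹≈ε) (identityʳ _))
  ·ℤ-⊖ (suc m) (suc n) x = begin
    (suc m ⊖ suc n) ·ℤ x              ≡⟨ Eq.cong (_·ℤ x) (ℤP.[1+m]⊖[1+n]≡m⊖n m n) ⟩
    (m ⊖ n) ·ℤ x                      ≈⟨ ·ℤ-⊖ m n x ⟩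
    m · x ∙ (n · x) ⁻¹                ≈⟨ sym (identityˡ _) ⟩
    ε ∙ (m · x ∙ (n · x) ⁻¹)          ≈⟨ ∙-cong (sym (inverseʳ x)) refl ⟩
    (x ∙ x ⁻¹) ∙ (m · x ∙ (n · x) ⁻¹) ≈⟨ interchange _ _ _ _ ⟩
    (x ∙ m · x) ∙ (x ⁻¹ ∙ (n · x) ⁻¹) ≈⟨ ∙-cong refl (⁻¹-∙-comm _ _) ⟩
    suc m · x ∙ (suc n · x) ⁻¹        ∎

  ·ℤ-distribʳ-+ : ∀ z w x → (z ℤ.+ w) ·ℤ x ≈ z ·ℤ x ∙ w ·ℤ x
  ·ℤ-distribʳ-+ (+ m)      (+ n)      x = ·-distribʳ-+ m n x
  ·ℤ-distribʳ-+ (+ m)      (-[1+ n ]) x = ·ℤ-⊖ m (suc n) x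
  ·ℤ-distribʳ-+ (-[1+ m ]) (+ n)      x = trans (·ℤ-⊖ n (suc m) x) (comm _ _)
  ·ℤ-distribʳ-+ (-[1+ m ]) (-[1+ n ]) x = begin
    (suc (suc m + n) · x) ⁻¹         ≡⟨ Eq.cong (λ k → (suc k · x) ⁻¹) (Eq.sym (ℕP.+-suc m n)) ⟩
    (x ∙ (m + suc n) · x) ⁻¹         ≈⟨ ⁻¹-cong (∙-cong refl (·-distribʳ-+ m (suc n) x)) ⟩
    (x ∙ (m · x ∙ suc n · x)) ⁻¹     ≈⟨ ⁻¹-cong (sym (assoc _ _ _)) ⟩
    (suc m · x ∙ suc n · x) ⁻¹       ≈⟨ sym (⁻¹-∙-comm _ _) ⟩
    (suc m · x) ⁻¹ ∙ (suc n · x) ⁻¹  ∎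

  ·ℤ-assoc-+ : ∀ z m x → (z ℤ.* + m) ·ℤ x ≈ z ·ℤ m · x
  ·ℤ-assoc-+ (+ n)      m x = Eq.subst (λ k → k ·ℤ x ≈ n · m · x) (ℤP.pos-* n m) (·-assoc n m x)
  ·ℤ-assoc-+ (-[1+ n ]) m x = begin
    (-[1+ n ] ℤ.* + m) ·ℤ x       ≡⟨ Eq.cong (_·ℤ x) (Eq.sym (ℤP.neg-distribˡ-* (+ suc n) (+ m))) ⟩
    (ℤ.- (+ suc n ℤ.* + m)) ·ℤ x  ≈⟨ ·ℤ-neg (+ suc n ℤ.* + m) x ⟩
    ((+ suc n ℤ.* + m) ·ℤ x) ⁻¹   ≈⟨ ⁻¹-cong (·ℤ-assoc-+ (+ suc n) m x) ⟩
    (suc n · m · x) ⁻¹            ∎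

  ·ℤ-assoc : ∀ z w x → (z ℤ.* w) ·ℤ x ≈ z ·ℤ w ·ℤ x
  ·ℤ-assoc z (+ m)      x = ·ℤ-assoc-+ z m x
  ·ℤ-assoc z (-[1+ m ]) x = begin
    (z ℤ.* -[1+ m ]) ·ℤ x        ≡⟨ Eq.cong (_·ℤ x) (Eq.sym (ℤP.neg-distribʳ-* z (+ suc m))) ⟩
    (ℤ.- (z ℤ.* + suc m)) ·ℤ x   ≈⟨ ·ℤ-neg (z ℤ.* + suc m) x ⟩
    ((z ℤ.* + suc m) ·ℤ x) ⁻¹    ≈⟨ ⁻¹-cong (·ℤ-assoc-+ z (suc m) x) ⟩
    (z ·ℤ suc m · x) ⁻¹          ≈⟨ sym (·ℤ-⁻¹ z _) ⟩
    z ·ℤ ((suc m · x) ⁻¹)        ∎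

  ·ℤ-comm-· : ∀ z m x → z ·ℤ m · x ≈ m · z ·ℤ x
  ·ℤ-comm-· (+ n)      m x = ·-comm n m x
  ·ℤ-comm-· (-[1+ n ]) m x = trans (⁻¹-cong (·-comm (suc n) m x)) (sym (·-⁻¹ m _))

  ∑< : ℕ → (ℕ → Carrier) → Carrier
  ∑< zero    f = ε
  ∑< (suc N) f = ∑< N f ∙ f N

  ∑<-cong< : ∀ N {f g : ℕ → Carrier} → (∀ i → i < N → f i ≈ g i) → ∑< N f ≈ ∑< N g
  ∑<-cong< zero    p = refl
  ∑<-cong< (suc N) p = ∙-cong (∑<-cong< N (λ i i<N → p i (ℕP.m<n⇒m<1+n i<N))) (p N ℕP.≤-refl)

  ∑<-cong : ∀ N {f g : ℕ → Carrier} → (∀ i → f i ≈ g i) → ∑< N f ≈ ∑< N g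
  ∑<-cong N p = ∑<-cong< N (λ i _ → p i)

  ∑<-ε : ∀ N {f : ℕ → Carrier} → (∀ i → i < N → f i ≈ ε) → ∑< N f ≈ ε
  ∑<-ε zero    p = refl
  ∑<-ε (suc N) p =
    trans (∙-cong (∑<-ε N (λ i i<N → p i (ℕP.m<n⇒m<1+n i<N))) (p N ℕP.≤-refl)) (identityˡ ε)

  ∑<-distrib-∙ : ∀ N f g → ∑< N (λ i → f i ∙ g i) ≈ ∑< N f ∙ ∑< N g
  ∑<-distrib-∙ zero    f g = sym (identityˡ ε)
  ∑<-distrib-∙ (suc N) f g = trans (∙-cong (∑<-distrib-∙ N f g) refl) (interchange _ _ _ _)

  ∑<-⁻¹ : ∀ N f → ∑< N (λ i → f i ⁻¹) ≈ (∑< N f) ⁻¹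
  ∑<-⁻¹ zero    f = sym ε⁻¹≈ε
  ∑<-⁻¹ (suc N) f = trans (∙-cong (∑<-⁻¹ N f) refl) (⁻¹-∙-comm _ _)

  ∑<-·ℤ : ∀ N z f → ∑< N (λ i → z ·ℤ f i) ≈ z ·ℤ ∑< N f
  ∑<-·ℤ zero    z f = sym (·ℤ-ε z)
  ∑<-·ℤ (suc N) z f = trans (∙-cong (∑<-·ℤ N z f) refl) (sym (·ℤ-distribˡ-∙ z _ _))

  ∑<-extend : ∀ M N f → M ≤ N → (∀ i → M ≤ i → f i ≈ ε) → ∑< N f ≈ ∑< M f
  ∑<-extend M zero    f z≤n  p = refl
  ∑<-extend M (suc N) f M≤sN p with ℕP.m≤n⇒m<n∨m≡n M≤sN
  ... | inj₁ M<sN =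
    trans (∙-cong (∑<-extend M N f (ℕP.≤-pred M<sN) p) (p N (ℕP.≤-pred M<sN))) (identityʳ _)
  ... | inj₂ Eq.refl = refl

  ∑<-single : ∀ N i f → i < N → (∀ j → ¬ (j ≡ i) → f j ≈ ε) → ∑< N f ≈ f i
  ∑<-single zero    i f () p
  ∑<-single (suc N) i f i<sN p with i ℕ.≟ N
  ... | yes Eq.refl =
    trans (∙-cong (∑<-ε N (λ j j<i → p j (λ { Eq.refl → ℕP.<-irrefl Eq.refl j<i }))) refl) (identityˡ _)
  ... | no i≢N =
    trans (∙-cong (∑<-single N i f (ℕP.≤∧≢⇒< (ℕP.≤-pred i<sN) i≢N) p) (p N (λ e → i≢N (Eq.sym e))))
          (identityʳ _)

  ∑<-swap : ∀ N M (f : ℕ → ℕ → Carrier) →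
            ∑< N (λ i → ∑< M (f i)) ≈ ∑< M (λ j → ∑< N (λ i → f i j))
  ∑<-swap zero    M f = sym (∑<-ε M (λ _ _ → refl))
  ∑<-swap (suc N) M f = begin
    ∑< N (λ i → ∑< M (f i)) ∙ ∑< M (f N)         ≈⟨ ∙-cong (∑<-swap N M f) refl ⟩
    ∑< M (λ j → ∑< N (λ i → f i j)) ∙ ∑< M (f N) ≈⟨ sym (∑<-distrib-∙ M _ _) ⟩
    ∑< M (λ j → ∑< N (λ i → f i j) ∙ f N j)      ∎

-- Elementary arithmetic

least-witness : {p : Level} {P : ℕ → Set p} → (∀ n → Dec (P n)) →
                ∀ N → P N → ∃ λ n → P n × (∀ m → m < n → ¬ P m)
least-witness {P = P} P? = <-rec _ search
  where
    search : ∀ N → (∀ {M} → M < N → P M → ∃ λ n → P n × (∀ m → m < n → ¬ P m)) →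
             P N → ∃ λ n → P n × (∀ m → m < n → ¬ P m)
    search N smaller pN with ℕP.anyUpTo? P? N
    ... | yes (M , M<N , pM) = smaller M<N pM
    ... | no none            = N , pN , λ m m<N pm → none (m , m<N , pm)

cast-+* : ∀ a b c → + (a + b * c) ≡ + a ℤ.+ + b ℤ.* + c
cast-+* a b c = Eq.trans (ℤP.pos-+ a (b * c)) (Eq.cong (ℤ._+_ (+ a)) (ℤP.pos-* b c))

bézout : ∀ m n → ∃ λ x → ∃ λ y → + gcd m n ≡ x ℤ.* + m ℤ.+ y ℤ.* + n
bézout m n with Bézout.identity (gcd-GCD m n)
... | Bézout.Identity.+- x y g+yn≡xm = + x , ℤ.- + y , (begin
  + gcd m n                                        ≡⟨ cancel (+ gcd m n) (+ y ℤ.* + n) ⟩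
  (+ gcd m n ℤ.+ + y ℤ.* + n) ℤ.- + y ℤ.* + n      ≡⟨ Eq.cong (ℤ._- + y ℤ.* + n) (cast-+* (gcd m n) y n) ⟨
  + (gcd m n + y * n) ℤ.- + y ℤ.* + n              ≡⟨ Eq.cong (λ z → + z ℤ.- + y ℤ.* + n) g+yn≡xm ⟩
  + (x * m) ℤ.- + y ℤ.* + n                        ≡⟨ Eq.cong₂ ℤ._+_ (ℤP.pos-* x m) (ℤP.neg-distribˡ-* (+ y) (+ n)) ⟩
  + x ℤ.* + m ℤ.+ ℤ.- + y ℤ.* + n                  ∎)
  where
    open Eq.≡-Reasoning
    cancel : ∀ a b → a ≡ (a ℤ.+ b) ℤ.- b
    cancel = solve-∀
... | Bézout.Identity.-+ x y g+xm≡yn = ℤ.- + x , + y , (begin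
  + gcd m n                                        ≡⟨ cancel (+ gcd m n) (+ x ℤ.* + m) ⟩
  (+ gcd m n ℤ.+ + x ℤ.* + m) ℤ.- + x ℤ.* + m      ≡⟨ Eq.cong (ℤ._- + x ℤ.* + m) (cast-+* (gcd m n) x m) ⟨
  + (gcd m n + x * m) ℤ.- + x ℤ.* + m              ≡⟨ Eq.cong (λ z → + z ℤ.- + x ℤ.* + m) g+xm≡yn ⟩
  + (y * n) ℤ.- + x ℤ.* + m                        ≡⟨ Eq.cong (ℤ._- + x ℤ.* + m) (ℤP.pos-* y n) ⟩
  + y ℤ.* + n ℤ.- + x ℤ.* + m                      ≡⟨ swap (+ y ℤ.* + n) (+ x) (+ m) ⟩
  ℤ.- + x ℤ.* + m ℤ.+ + y ℤ.* + n                  ∎)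
  where
    open Eq.≡-Reasoning
    cancel : ∀ a b → a ≡ (a ℤ.+ b) ℤ.- b
    cancel = solve-∀
    swap : ∀ a x m → a ℤ.- x ℤ.* m ≡ ℤ.- x ℤ.* m ℤ.+ a
    swap = solve-∀

module PrimePowers (l : ℕ) (l-prime : Prime l) where
  open Prime l-prime using (nontrivial)

  1<l : 1 < l
  1<l = ℕ.nonTrivial⇒n>1 l

  instance
    l-nonZero : NonZero l
    l-nonZero = ℕ.nonTrivial⇒nonZero l

  l^-nonZero : ∀ n → NonZero (l ^ n)
  l^-nonZero n = ℕP.m^n≢0 l n


  ∤⇒coprime : ∀ {d} → ¬ (l ∣ d) → Coprime d l
  ∤⇒coprime l∤d (x∣d , x∣l) with prime⇒irreducible l-prime x∣l
  ... | inj₁ x≡1     = x≡1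
  ... | inj₂ Eq.refl = ⊥-elim (l∤d x∣d)

  ∣l^k⇒≡l^e : ∀ k d → d ∣ l ^ k → ∃ λ e → d ≡ l ^ e
  ∣l^k⇒≡l^e zero    d d∣1 = 0 , ∣1⇒≡1 d∣1
  ∣l^k⇒≡l^e (suc k) d d∣ with l ∣? d
  ... | yes (divides q Eq.refl) =
    let (e , q≡) = ∣l^k⇒≡l^e k q (*-cancelˡ-∣ l (Eq.subst (_∣ l * l ^ k) (ℕP.*-comm q l) d∣))
    in suc e , Eq.trans (Eq.cong (_* l) q≡) (ℕP.*-comm (l ^ e) l)
  ... | no l∤d = ∣l^k⇒≡l^e k d (coprime-divisor (∤⇒coprime l∤d) d∣)

  n<l^n : ∀ n → n < l ^ n
  n<l^n zero    = s≤s z≤n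
  n<l^n (suc n) = ℕP.<-≤-trans (s≤s (n<l^n n))
    (Eq.subst (suc (l ^ n) ≤_) (ℕP.*-comm (l ^ n) l) (ℕP.m<m*n (l ^ n) l {{l^-nonZero n}} 1<l))

  ^-cancelʳ-< : ∀ m n → l ^ m < l ^ n → m < n
  ^-cancelʳ-< m n lt with suc m ℕ.≤? n
  ... | yes m<n = m<n
  ... | no  m≮n = ⊥-elim (ℕP.<⇒≱ lt (ℕP.^-monoʳ-≤ l (ℕP.≤-pred (ℕP.≰⇒> m≮n))))

  l^-split : ∀ m n → m ≤ n → l ^ n ≡ l ^ (n ∸ m) * l ^ m
  l^-split m n m≤n = Eq.trans (Eq.cong (l ^_) (Eq.sym (ℕP.m∸n+n≡m m≤n))) (ℕP.^-distribˡ-+-* l (n ∸ m) m)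

  -- With gcd k (l ^ N) = l ^ e = x k + y l ^ N (e < k) and K′ = N − e, multiplying by
  -- l ^ K′ gives l ^ N = (x l ^ K′) k + (y l ^ K′) l ^ N.
  ∣l^N*[1+u*l^K′] : ∀ k K N → 1 ≤ k → k + K ≤ N →
    ∃ λ w → ∃ λ u → ∃ λ K′ → (K ≤ K′) × (+ k ℤ.* w ≡ + (l ^ N) ℤ.* (+ 1 ℤ.+ u ℤ.* + (l ^ K′)))
  ∣l^N*[1+u*l^K′] k K N 1≤k k+K≤N = x ℤ.* + R , ℤ.- y , K′ , K≤K′ , (begin
    + k ℤ.* (x ℤ.* + R)                                  ≡⟨ expand (+ k) x y (+ L) (+ R) ⟩
    (x ℤ.* + k ℤ.+ y ℤ.* + L) ℤ.* + R ℤ.- y ℤ.* + R ℤ.* + L ≡⟨ Eq.cong (λ z → z ℤ.* + R ℤ.- y ℤ.* + R ℤ.* + L) g≡xk+yL ⟨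
    + g ℤ.* + R ℤ.- y ℤ.* + R ℤ.* + L                    ≡⟨ Eq.cong (λ z → z ℤ.- y ℤ.* + R ℤ.* + L) (Eq.trans (Eq.sym (ℤP.pos-* g R)) (Eq.cong +_ g*R≡L)) ⟩
    + L ℤ.- y ℤ.* + R ℤ.* + L                            ≡⟨ factor (+ L) y (+ R) ⟩
    + L ℤ.* (+ 1 ℤ.+ ℤ.- y ℤ.* + R)                      ∎)
    where
      open Eq.≡-Reasoning
      L : ℕ
      L = l ^ N
      g : ℕ
      g = gcd k L
      x y : ℤ
      x = proj₁ (bézout k L)
      y = proj₁ (proj₂ (bézout k L))
      g≡xk+yL : + g ≡ x ℤ.* + k ℤ.+ y ℤ.* + L
      g≡xk+yL = proj₂ (proj₂ (bézout k L))
      g-power : ∃ λ e → g ≡ l ^ e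
      g-power = ∣l^k⇒≡l^e N g (gcd[m,n]∣n k L)
      e : ℕ
      e = proj₁ g-power
      e<k : e < k
      e<k = ℕP.<-≤-trans (n<l^n e) (ℕP.≤-trans (ℕP.≤-reflexive (Eq.sym (proj₂ g-power)))
                                                (∣⇒≤ {{ℕ.>-nonZero 1≤k}} (gcd[m,n]∣m k L)))
      e≤N : e ≤ N
      e≤N = ℕP.≤-trans (ℕP.<⇒≤ e<k) (ℕP.≤-trans (ℕP.m≤m+n k K) k+K≤N)
      K′ : ℕ
      K′ = N ∸ e
      K≤K′ : K ≤ K′
      K≤K′ = ℕP.≤-trans (ℕP.m≤n+m K (k ∸ e))
        (ℕP.≤-trans (ℕP.≤-reflexive (Eq.sym (ℕP.+-∸-comm K (ℕP.<⇒≤ e<k)))) (ℕP.∸-monoˡ-≤ e k+K≤N))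
      R : ℕ
      R = l ^ K′
      g*R≡L : g * R ≡ L
      g*R≡L = Eq.trans (Eq.cong (_* R) (proj₂ g-power))
                       (Eq.trans (ℕP.*-comm (l ^ e) R) (Eq.sym (l^-split e N e≤N)))
      expand : ∀ k x y L R → k ℤ.* (x ℤ.* R) ≡ (x ℤ.* k ℤ.+ y ℤ.* L) ℤ.* R ℤ.- y ℤ.* R ℤ.* L
      expand = solve-∀
      factor : ∀ L y R → L ℤ.- y ℤ.* R ℤ.* L ≡ L ℤ.* (+ 1 ℤ.+ ℤ.- y ℤ.* R)
      factor = solve-∀

exactQuotient : ℤ → (L : ℕ) → .{{NonZero L}} → ℤ
exactQuotient (+ m)      L = + (m / L)
exactQuotient (-[1+ m ]) L = ℤ.- (+ (suc m / L))

exactQuotient-correct : ∀ z L .{{_ : NonZero L}} → L ∣ ℤ.∣ z ∣ → z ≡ exactQuotient z L ℤ.* + L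
exactQuotient-correct (+ m) L d = Eq.trans (Eq.cong +_ (Eq.sym (m/n*n≡m d))) (ℤP.pos-* (m / L) L)
exactQuotient-correct (-[1+ m ]) L d = begin
  -[1+ m ]                       ≡⟨ Eq.cong (λ k → ℤ.- (+ k)) (Eq.sym (m/n*n≡m d)) ⟩
  ℤ.- (+ (suc m / L * L))        ≡⟨ Eq.cong ℤ.-_ (ℤP.pos-* (suc m / L) L) ⟩
  ℤ.- (+ (suc m / L) ℤ.* + L)    ≡⟨ ℤP.neg-distribˡ-* (+ (suc m / L)) (+ L) ⟩
  ℤ.- (+ (suc m / L)) ℤ.* + L    ∎
  where open Eq.≡-Reasoning

exactQuotient-0 : ∀ L .{{_ : NonZero L}} → exactQuotient 0ℤ L ≡ 0ℤ
exactQuotient-0 L = Eq.cong +_ (0/n≡0 L)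

maxFin : ∀ m → (Fin m → ℕ) → ℕ
maxFin zero    f = 0
maxFin (suc m) f = f Fin.zero ⊔ℕ maxFin m (λ j → f (Fin.suc j))

≤-maxFin : ∀ m f j → f j ≤ maxFin m f
≤-maxFin (suc m) f Fin.zero    = ℕP.m≤m⊔n _ _
≤-maxFin (suc m) f (Fin.suc j) = ℕP.≤-trans (≤-maxFin m (λ j → f (Fin.suc j)) j) (ℕP.m≤n⊔m _ _)

max< : ℕ → (ℕ → ℕ) → ℕ
max< zero    f = 0
max< (suc N) f = max< N f ⊔ℕ f N

≤-max< : ∀ N f i → i < N → f i ≤ max< N f
≤-max< (suc N) f i i<sN with i ℕ.≟ N
... | yes Eq.refl = ℕP.m≤n⊔m _ _
... | no  i≢N     = ℕP.≤-trans (≤-max< N f i (ℕP.≤∧≢⇒< (ℕP.≤-pred i<sN) i≢N)) (ℕP.m≤m⊔n _ _)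

even : ℕ → Bool
even zero          = true
even (suc zero)    = false
even (suc (suc n)) = even n

double : ℕ → ℕ
double zero    = zero
double (suc k) = suc (suc (double k))

even-double : ∀ k → even (double k) ≡ true
even-double zero    = Eq.refl
even-double (suc k) = even-double k

even-suc-double : ∀ k → even (suc (double k)) ≡ false
even-suc-double zero    = Eq.refl
even-suc-double (suc k) = even-suc-double k

≤-double : ∀ k → k ≤ double k
≤-double zero    = z≤n
≤-double (suc k) = s≤s (ℕP.m≤n⇒m≤1+n (≤-double k))

-- Finitely supported integer sequences

record FinSupp : Set where
  constructor mkFinSupp
  field
    coeff     : ℕ → ℤ
    bd        : ℕ
    beyond-bd : ∀ i → bd ≤ i → coeff i ≡ 0ℤ
open FinSupp public

nonzero⇒<bd : ∀ (e : FinSupp) j → ¬ (coeff e j ≡ 0ℤ) → j < bd e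
nonzero⇒<bd e j ne with j ℕ.<? bd e
... | yes j<bd = j<bd
... | no  j≮bd = ⊥-elim (ne (beyond-bd e j (ℕP.≮⇒≥ j≮bd)))

infixl 6 _⊕_
infixr 7 _⊛_

_⊕_ : FinSupp → FinSupp → FinSupp
f ⊕ g = mkFinSupp (λ i → coeff f i ℤ.+ coeff g i) (bd f ⊔ℕ bd g)
  (λ i le → Eq.cong₂ ℤ._+_ (beyond-bd f i (ℕP.≤-trans (ℕP.m≤m⊔n _ _) le))
                           (beyond-bd g i (ℕP.≤-trans (ℕP.m≤n⊔m _ _) le)))

⊝_ : FinSupp → FinSupp
⊝ f = mkFinSupp (λ i → ℤ.- coeff f i) (bd f) (λ i le → Eq.cong ℤ.-_ (beyond-bd f i le))

0ᶠ : FinSupp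
0ᶠ = mkFinSupp (λ _ → 0ℤ) 0 (λ _ _ → Eq.refl)

_⊛_ : ℤ → FinSupp → FinSupp
z ⊛ f = mkFinSupp (λ i → z ℤ.* coeff f i) (bd f)
  (λ i le → Eq.trans (Eq.cong (z ℤ.*_) (beyond-bd f i le)) (ℤP.*-zeroʳ z))

δ : ℕ → ℤ → ℕ → ℤ
δ i z j with j ℕ.≟ i
... | yes _ = z
... | no  _ = 0ℤ

δ-same : ∀ i z → δ i z i ≡ z
δ-same i z with i ℕ.≟ i
... | yes _  = Eq.refl
... | no  ¬p = ⊥-elim (¬p Eq.refl)

δ-other : ∀ i z j → ¬ (j ≡ i) → δ i z j ≡ 0ℤ
δ-other i z j j≢i with j ℕ.≟ i
... | yes j≡i = ⊥-elim (j≢i j≡i)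
... | no  _   = Eq.refl

single : ℕ → ℤ → FinSupp
single i z = mkFinSupp (δ i z) (suc i) (λ j i<j → δ-other i z j (λ { Eq.refl → ℕP.<-irrefl Eq.refl i<j }))

module Combination {a ℓa : Level} (G : AbelianGroup a ℓa) where
  open AbelianGroup G
  open Powers G
  open SetoidReasoning setoid

  term : (ℕ → Carrier) → FinSupp → ℕ → Carrier
  term γ d i = coeff d i ·ℤ γ i

  ⟪_∣_⟫ : (ℕ → Carrier) → FinSupp → Carrier
  ⟪ γ ∣ d ⟫ = ∑< (bd d) (term γ d)

  ·ℤ-0 : ∀ {z} x → z ≡ 0ℤ → z ·ℤ x ≈ ε
  ·ℤ-0 x Eq.refl = refl

  ⟪⟫-extend : ∀ γ d N → bd d ≤ N → ∑< N (term γ d) ≈ ⟪ γ ∣ d ⟫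
  ⟪⟫-extend γ d N le = ∑<-extend (bd d) N (term γ d) le (λ i bd≤i → ·ℤ-0 (γ i) (beyond-bd d i bd≤i))

  ⟪⟫-cong : ∀ {γ γ′} f g → (∀ i → γ i ≈ γ′ i) → (∀ i → coeff f i ≡ coeff g i) → ⟪ γ ∣ f ⟫ ≈ ⟪ γ′ ∣ g ⟫
  ⟪⟫-cong {γ} {γ′} f g γ≈γ′ f≡g = begin
    ⟪ γ ∣ f ⟫          ≈⟨ sym (⟪⟫-extend γ f N (ℕP.m≤m⊔n _ _)) ⟩
    ∑< N (term γ f)    ≈⟨ ∑<-cong N (λ i → Eq.subst (λ z → term γ f i ≈ z ·ℤ γ′ i) (f≡g i) (·ℤ-cong (coeff f i) (γ≈γ′ i))) ⟩
    ∑< N (term γ′ g)   ≈⟨ ⟪⟫-extend γ′ g N (ℕP.m≤n⊔m _ _) ⟩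
    ⟪ γ′ ∣ g ⟫         ∎
    where
      N : ℕ
      N = bd f ⊔ℕ bd g

  ⟪⟫-⊕ : ∀ γ f g → ⟪ γ ∣ f ⊕ g ⟫ ≈ ⟪ γ ∣ f ⟫ ∙ ⟪ γ ∣ g ⟫
  ⟪⟫-⊕ γ f g = begin
    ⟪ γ ∣ f ⊕ g ⟫                          ≈⟨ ∑<-cong N (λ i → ·ℤ-distribʳ-+ (coeff f i) (coeff g i) (γ i)) ⟩
    ∑< N (λ i → term γ f i ∙ term γ g i)   ≈⟨ ∑<-distrib-∙ N _ _ ⟩
    ∑< N (term γ f) ∙ ∑< N (term γ g)      ≈⟨ ∙-cong (⟪⟫-extend γ f N (ℕP.m≤m⊔n _ _)) (⟪⟫-extend γ g N (ℕP.m≤n⊔m _ _)) ⟩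
    ⟪ γ ∣ f ⟫ ∙ ⟪ γ ∣ g ⟫                  ∎
    where
      N : ℕ
      N = bd f ⊔ℕ bd g

  ⟪⟫-⊝ : ∀ γ f → ⟪ γ ∣ ⊝ f ⟫ ≈ ⟪ γ ∣ f ⟫ ⁻¹
  ⟪⟫-⊝ γ f = trans (∑<-cong (bd f) (λ i → ·ℤ-neg (coeff f i) (γ i))) (∑<-⁻¹ (bd f) _)

  ⟪⟫-⊛ : ∀ γ z f → ⟪ γ ∣ z ⊛ f ⟫ ≈ z ·ℤ ⟪ γ ∣ f ⟫
  ⟪⟫-⊛ γ z f = trans (∑<-cong (bd f) (λ i → ·ℤ-assoc z (coeff f i) (γ i))) (∑<-·ℤ (bd f) z _)

  ⟪⟫-single : ∀ γ i z → ⟪ γ ∣ single i z ⟫ ≈ z ·ℤ γ i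
  ⟪⟫-single γ i z = begin
    ⟪ γ ∣ single i z ⟫  ≈⟨ ∑<-single (suc i) i (term γ (single i z)) ℕP.≤-refl (λ j j≢i → ·ℤ-0 (γ j) (δ-other i z j j≢i)) ⟩
    δ i z i ·ℤ γ i      ≡⟨ Eq.cong (_·ℤ γ i) (δ-same i z) ⟩
    z ·ℤ γ i            ∎

-- Finite cyclic l-groups

%ℕ≡0⇒∣ : ∀ z d .{{_ : NonZero d}} → z %ℕ d ≡ 0 → d ∣ ℤ.∣ z ∣
%ℕ≡0⇒∣ z d r≡0 = divides ℤ.∣ z /ℕ d ∣ (begin
  ℤ.∣ z ∣                                ≡⟨ Eq.cong ℤ.∣_∣ (a≡a%ℕn+[a/ℕn]*n z d) ⟩
  ℤ.∣ + (z %ℕ d) ℤ.+ (z /ℕ d) ℤ.* + d ∣  ≡⟨ Eq.cong (λ k → ℤ.∣ + k ℤ.+ (z /ℕ d) ℤ.* + d ∣) r≡0 ⟩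
  ℤ.∣ 0ℤ ℤ.+ (z /ℕ d) ℤ.* + d ∣          ≡⟨ Eq.cong ℤ.∣_∣ (ℤP.+-identityˡ ((z /ℕ d) ℤ.* + d)) ⟩
  ℤ.∣ (z /ℕ d) ℤ.* + d ∣                 ≡⟨ ℤP.abs-* (z /ℕ d) (+ d) ⟩
  ℤ.∣ z /ℕ d ∣ * d                       ∎)
  where open Eq.≡-Reasoning

module _ {c ℓ : Level} (G : AbelianGroup c ℓ) where
  open AbelianGroup G

  finite⇒≈-dec : IsFinite G → ∀ x y → Dec (x ≈ y)
  finite⇒≈-dec (m , f , f-inj , f-surj) x y with f-surj x | f-surj y
  ... | i , fi≈x | j , fj≈y with i Fin.≟ j
  ... | yes Eq.refl = yes (trans (sym fi≈x) fj≈y)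
  ... | no  i≢j     = no (λ x≈y → i≢j (f-inj i j (trans fi≈x (trans x≈y (sym fj≈y)))))

module CyclicLGroup (l : ℕ) (l-prime : Prime l) {c ℓ : Level} (G : AbelianGroup c ℓ)
                    (cyclic : IsCyclic G) (finite : IsFinite G) (l-group : IsTorsionLGroup G l) where
  open AbelianGroup G
  open Powers G
  open PrimePowers l l-prime
  open SetoidReasoning setoid

  generator : Carrier
  generator = proj₁ cyclic

  private
    g : Carrier
    g = generator

  generates : ∀ x → Σ ℤ λ z → z ·ℤ g ≈ x
  generates x with proj₂ cyclic x
  ... | k , inj₁ p = + k , p
  ... | k , inj₂ p = ℤ.- (+ k) , trans (·ℤ-neg (+ k) g) p

  private
    Kills : ℕ → Set ℓ
    Kills o = (1 ≤ o) × (o · g ≈ ε)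

    kills? : ∀ o → Dec (Kills o)
    kills? zero    = no λ ()
    kills? (suc o) with finite⇒≈-dec G finite (suc o · g) ε
    ... | yes p = yes (s≤s z≤n , p)
    ... | no ¬p = no λ k → ¬p (proj₂ k)

    k₀ : ℕ
    k₀ = proj₁ (l-group g)

    order-witness : ∃ λ o → Kills o × (∀ m → m < o → ¬ Kills m)
    order-witness = least-witness kills? (l ^ k₀) (ℕP.m^n>0 l k₀ , proj₂ (l-group g))

    order : ℕ
    order = proj₁ order-witness

    instance
      order-nonZero : NonZero order
      order-nonZero = ℕ.>-nonZero (proj₁ (proj₁ (proj₂ order-witness)))

    order·g≈ε : order · g ≈ ε
    order·g≈ε = proj₂ (proj₁ (proj₂ order-witness))

    ·ℤ-reduce : ∀ z → z ·ℤ g ≈ (z %ℕ order) · g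
    ·ℤ-reduce z = begin
      z ·ℤ g                                                  ≡⟨ Eq.cong (_·ℤ g) (a≡a%ℕn+[a/ℕn]*n z order) ⟩
      (+ (z %ℕ order) ℤ.+ (z /ℕ order) ℤ.* + order) ·ℤ g     ≈⟨ ·ℤ-distribʳ-+ (+ (z %ℕ order)) ((z /ℕ order) ℤ.* + order) g ⟩
      (z %ℕ order) · g ∙ ((z /ℕ order) ℤ.* + order) ·ℤ g     ≈⟨ ∙-cong refl (·ℤ-assoc-+ (z /ℕ order) order g) ⟩
      (z %ℕ order) · g ∙ (z /ℕ order) ·ℤ order · g           ≈⟨ ∙-cong refl (trans (·ℤ-cong (z /ℕ order) order·g≈ε) (·ℤ-ε (z /ℕ order))) ⟩
      (z %ℕ order) · g ∙ ε                                    ≈⟨ identityʳ _ ⟩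
      (z %ℕ order) · g                                        ∎

    -- Minimality of the order forces the remainder to vanish.
    ·ℤg≈ε⇒order∣ : ∀ z → z ·ℤ g ≈ ε → order ∣ ℤ.∣ z ∣
    ·ℤg≈ε⇒order∣ z zg≈ε with z %ℕ order in r≡ | proj₂ (proj₂ order-witness) (z %ℕ order) (n%ℕd<d z order)
    ... | suc r | not-killed = ⊥-elim (not-killed (s≤s z≤n ,
            Eq.subst (λ k → k · g ≈ ε) r≡ (trans (sym (·ℤ-reduce z)) zg≈ε)))
    ... | zero  | _ = %ℕ≡0⇒∣ z order r≡

    order-is-power : ∃ λ e → order ≡ l ^ e
    order-is-power = ∣l^k⇒≡l^e k₀ order (·ℤg≈ε⇒order∣ (+ (l ^ k₀)) (proj₂ (l-group g)))

  opaque
    exponent : ℕ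
    exponent = proj₁ order-is-power

    private
      order≡ : order ≡ l ^ exponent
      order≡ = proj₂ order-is-power

  l^exponent·g≈ε : (l ^ exponent) · g ≈ ε
  l^exponent·g≈ε = Eq.subst (λ k → k · g ≈ ε) order≡ order·g≈ε

  ·ℤg≈ε⇒l^exponent∣ : ∀ z → z ·ℤ g ≈ ε → l ^ exponent ∣ ℤ.∣ z ∣
  ·ℤg≈ε⇒l^exponent∣ z p = Eq.subst (_∣ ℤ.∣ z ∣) order≡ (·ℤg≈ε⇒order∣ z p)

  multiple·ℤg≈ε : ∀ z → (z ℤ.* + (l ^ exponent)) ·ℤ g ≈ ε
  multiple·ℤg≈ε z = trans (·ℤ-assoc-+ z (l ^ exponent) g) (trans (·ℤ-cong z l^exponent·g≈ε) (·ℤ-ε z))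

  card≤l^exponent : ∀ m → HasCard G m → m ≤ l ^ exponent
  card≤l^exponent m (f , f-inj , _) = Eq.subst (m ≤_) order≡ (FinP.injective⇒≤ {f = residue} residue-injective)
    where
      z : Fin m → ℤ
      z j = proj₁ (generates (f j))
      residue : Fin m → Fin order
      residue j = fromℕ< (n%ℕd<d (z j) order)
      residue-injective : ∀ {i j} → residue i ≡ residue j → i ≡ j
      residue-injective {i} {j} eq = f-inj i j (begin
        f i                       ≈⟨ sym (proj₂ (generates (f i))) ⟩
        z i ·ℤ g                  ≈⟨ ·ℤ-reduce (z i) ⟩
        (z i %ℕ order) · g        ≡⟨ Eq.cong (_· g) (FinP.fromℕ<-injective _ _ _ _ eq) ⟩
        (z j %ℕ order) · g        ≈⟨ sym (·ℤ-reduce (z j)) ⟩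
        z j ·ℤ g                  ≈⟨ proj₂ (generates (f j)) ⟩
        f j                       ∎)

-- Homomorphisms

module HomomorphismProperties {a ℓa b ℓb : Level} (G : AbelianGroup a ℓa) (H : AbelianGroup b ℓb)
  (h : AbelianGroup.Carrier G → AbelianGroup.Carrier H)
  (h-cong : ∀ {x y} → AbelianGroup._≈_ G x y → AbelianGroup._≈_ H (h x) (h y))
  (h-homo : ∀ x y → AbelianGroup._≈_ H (h (AbelianGroup._∙_ G x y)) (AbelianGroup._∙_ H (h x) (h y)))
  where
  private
    module G = AbelianGroup G
    module H = AbelianGroup H
    module GP = Powers G
    module HP = Powers H
  open H using (_≈_; _∙_; ε; _⁻¹)
  open SetoidReasoning H.setoid
  open GroupMorphisms G.rawGroup H.rawGroup

  h-ε : h G.ε ≈ ε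
  h-ε = begin
    h G.ε                         ≈⟨ H.sym (H.identityˡ _) ⟩
    ε ∙ h G.ε                     ≈⟨ H.∙-cong (H.sym (H.inverseˡ (h G.ε))) H.refl ⟩
    (h G.ε ⁻¹ ∙ h G.ε) ∙ h G.ε    ≈⟨ H.assoc _ _ _ ⟩
    h G.ε ⁻¹ ∙ (h G.ε ∙ h G.ε)    ≈⟨ H.∙-cong H.refl (H.sym (h-homo _ _)) ⟩
    h G.ε ⁻¹ ∙ h (G.ε G.∙ G.ε)    ≈⟨ H.∙-cong H.refl (h-cong (G.identityˡ _)) ⟩
    h G.ε ⁻¹ ∙ h G.ε              ≈⟨ H.inverseˡ _ ⟩
    ε                             ∎

  h-⁻¹ : ∀ x → h (x G.⁻¹) ≈ h x ⁻¹
  h-⁻¹ x = HP.inverseʳ-unique (h x) (h (x G.⁻¹))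
    (H.trans (H.sym (h-homo _ _)) (H.trans (h-cong (G.inverseʳ x)) h-ε))

  h-· : ∀ n x → h (n GP.· x) ≈ n HP.· h x
  h-· zero    x = h-ε
  h-· (suc n) x = H.trans (h-homo _ _) (H.∙-cong H.refl (h-· n x))

  h-·ℤ : ∀ z x → h (z GP.·ℤ x) ≈ z HP.·ℤ h x
  h-·ℤ (+ n)      x = h-· n x
  h-·ℤ (-[1+ n ]) x = H.trans (h-⁻¹ _) (H.⁻¹-cong (h-· (suc n) x))

  h-∑< : ∀ N f → h (GP.∑< N f) ≈ HP.∑< N (λ i → h (f i))
  h-∑< zero    f = h-ε
  h-∑< (suc N) f = H.trans (h-homo _ _) (H.∙-cong (h-∑< N f) H.refl)

  h-⟪⟫ : ∀ γ c → h (Combination.⟪_∣_⟫ G γ c) ≈ Combination.⟪_∣_⟫ H (λ i → h (γ i)) c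
  h-⟪⟫ γ c = H.trans (h-∑< (bd c) _) (HP.∑<-cong (bd c) (λ i → h-·ℤ (coeff c i) (γ i)))

  isGroupHomomorphism : IsGroupHomomorphism h
  isGroupHomomorphism = record
    { isMonoidHomomorphism = record
      { isMagmaHomomorphism = record
        { isRelHomomorphism = record { cong = h-cong }
        ; homo = h-homo }
      ; ε-homo = h-ε }
    ; ⁻¹-homo = h-⁻¹ }

record BijectiveHom {a ℓa b ℓb : Level} (G : AbelianGroup a ℓa) (H : AbelianGroup b ℓb)
                    : Set (a ⊔ ℓa ⊔ b ⊔ ℓb) where
  private
    module G = AbelianGroup G
    module H = AbelianGroup H
  field
    to        : G.Carrier → H.Carrier
    cong      : ∀ {x y} → x G.≈ y → to x H.≈ to y
    homo      : ∀ x y → to (x G.∙ y) H.≈ to x H.∙ to y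
    injective : ∀ {x y} → to x H.≈ to y → x G.≈ y
    section   : ∀ y → Σ G.Carrier λ x → to x H.≈ y

module _ {a ℓa b ℓb : Level} {G : AbelianGroup a ℓa} {H : AbelianGroup b ℓb} where
  private
    module G = AbelianGroup G
    module H = AbelianGroup H

  bijectiveHom⇒isomorphic : BijectiveHom G H → Isomorphic G H
  bijectiveHom⇒isomorphic f = to , record
    { isGroupMonomorphism = record
      { isGroupHomomorphism = HomomorphismProperties.isGroupHomomorphism G H to cong homo
      ; injective = injective }
    ; surjective = λ y → proj₁ (section y) , λ z≈x → H.trans (cong z≈x) (proj₂ (section y)) }
    where open BijectiveHom f

  inverse : BijectiveHom G H → BijectiveHom H G
  inverse f = record
    { to        = from
    ; cong      = λ {x} {y} p → injective (H.trans (to-from x) (H.trans p (H.sym (to-from y))))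
    ; homo      = λ x y → injective (H.trans (to-from (x H.∙ y))
                    (H.sym (H.trans (homo _ _) (H.∙-cong (to-from x) (to-from y)))))
    ; injective = λ {x} {y} p → H.trans (H.sym (to-from x)) (H.trans (cong p) (to-from y))
    ; section   = λ x → to x , injective (to-from (to x)) }
    where
      open BijectiveHom f
      from : H.Carrier → G.Carrier
      from y = proj₁ (section y)
      to-from : ∀ y → to (from y) H.≈ y
      to-from y = proj₂ (section y)

infixr 9 _∘ᵇ_

_∘ᵇ_ : {a ℓa b ℓb c ℓc : Level} {G : AbelianGroup a ℓa} {H : AbelianGroup b ℓb} {K : AbelianGroup c ℓc} →
       BijectiveHom H K → BijectiveHom G H → BijectiveHom G K
_∘ᵇ_ {K = K} g f = record
  { to        = λ x → g.to (f.to x)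
  ; cong      = λ p → g.cong (f.cong p)
  ; homo      = λ x y → K.trans (g.cong (f.homo x y)) (g.homo _ _)
  ; injective = λ p → f.injective (g.injective p)
  ; section   = λ z → proj₁ (f.section (proj₁ (g.section z))) ,
                      K.trans (g.cong (proj₂ (f.section _))) (proj₂ (g.section z)) }
  where
    module f = BijectiveHom f
    module g = BijectiveHom g
    module K = AbelianGroup K

-- Coordinates in a direct sum

module DirectSumCoordinates {c ℓ : Level} (C : ℕ → AbelianGroup c ℓ) where
  private
    module D  = AbelianGroup (⨁ C)
    module DS = DirectSum C
    module C i = AbelianGroup (C i)
    module CP i = Powers (C i)
    module DP = Powers (⨁ C)
    module DC = Combination (⨁ C)

  coord-· : ∀ n x j → C._≈_ j (DS.fn (n DP.· x) j) (CP._·_ j n (DS.fn x j))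
  coord-· zero    x j = C.refl j
  coord-· (suc n) x j = C.∙-cong j (C.refl j) (coord-· n x j)

  coord-·ℤ : ∀ z x j → C._≈_ j (DS.fn (z DP.·ℤ x) j) (CP._·ℤ_ j z (DS.fn x j))
  coord-·ℤ (+ n)      x j = coord-· n x j
  coord-·ℤ (-[1+ n ]) x j = C.⁻¹-cong j (coord-· (suc n) x j)

  coord-∑< : ∀ N f j → C._≈_ j (DS.fn (DP.∑< N f) j) (CP.∑< j N (λ i → DS.fn (f i) j))
  coord-∑< zero    f j = C.refl j
  coord-∑< (suc N) f j = C.∙-cong j (coord-∑< N f j) (C.refl j)

  private
    inj-fn : ∀ i → C.Carrier i → ∀ j → C.Carrier j
    inj-fn i y j with j ℕ.≟ i
    ... | yes Eq.refl = y
    ... | no  _       = C.ε j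

  inj : ∀ i → C.Carrier i → D.Carrier
  inj i y = DS.mkElt (inj-fn i y) (suc i) beyond
    where
      beyond : ∀ j → suc i ≤ j → C._≈_ j (inj-fn i y j) (C.ε j)
      beyond j i<j with j ℕ.≟ i
      ... | yes Eq.refl = ⊥-elim (ℕP.<-irrefl Eq.refl i<j)
      ... | no  _       = C.refl j

  inj-same : ∀ i y → C._≈_ i (DS.fn (inj i y) i) y
  inj-same i y with i ℕ.≟ i
  ... | yes Eq.refl = C.refl i
  ... | no  ¬p      = ⊥-elim (¬p Eq.refl)

  inj-other : ∀ i y j → ¬ (j ≡ i) → C._≈_ j (DS.fn (inj i y) j) (C.ε j)
  inj-other i y j j≢i with j ℕ.≟ i
  ... | yes j≡i = ⊥-elim (j≢i j≡i)
  ... | no  _   = C.refl j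

  coord-⟪inj⟫ : ∀ (y : ∀ i → C.Carrier i) c j →
                C._≈_ j (DS.fn DC.⟪ (λ i → inj i (y i)) ∣ c ⟫ j) (CP._·ℤ_ j (coeff c j) (y j))
  coord-⟪inj⟫ y c j = C.trans j (coord-∑< (bd c) _ j) coordinate
    where
      vanishing : ∀ i → ¬ (j ≡ i) → C._≈_ j (DS.fn (DC.term (λ i → inj i (y i)) c i) j) (C.ε j)
      vanishing i j≢i = C.trans j (coord-·ℤ (coeff c i) _ j)
        (C.trans j (CP.·ℤ-cong j (coeff c i) (inj-other i (y i) j j≢i)) (CP.·ℤ-ε j (coeff c i)))
      coordinate : C._≈_ j (CP.∑< j (bd c) (λ i → DS.fn (DC.term (λ i → inj i (y i)) c i) j))
                                 (CP._·ℤ_ j (coeff c j) (y j))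
      coordinate with j ℕ.<? bd c
      ... | yes j<bd = C.trans j (CP.∑<-single j (bd c) j _ j<bd (λ i i≢j → vanishing i (λ e → i≢j (Eq.sym e))))
                         (C.trans j (coord-·ℤ (coeff c j) _ j) (CP.·ℤ-cong j (coeff c j) (inj-same j (y j))))
      ... | no  j≮bd = C.trans j (CP.∑<-ε j (bd c) (λ i i<bd → vanishing i (λ { Eq.refl → j≮bd i<bd })))
                         (C.sym j (CombC.·ℤ-0 j (y j) (beyond-bd c j (ℕP.≮⇒≥ j≮bd))))
        where module CombC i = Combination (C i)

  ·-inj≈ε : ∀ k i y → C._≈_ i (CP._·_ i k y) (C.ε i) → k DP.· inj i y D.≈ D.ε
  ·-inj≈ε k i y ky≈ε j = C.trans j (coord-· k (inj i y) j) (coordinate (j ℕ.≟ i))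
    where
      coordinate : Dec (j ≡ i) → C._≈_ j (CP._·_ j k (DS.fn (inj i y) j)) (C.ε j)
      coordinate (yes Eq.refl) = C.trans j (CP.·-cong j k (inj-same j y)) ky≈ε
      coordinate (no j≢i)      = C.trans j (CP.·-cong j k (inj-other i y j j≢i)) (CP.·-ε j k)

-- The abelian group ⟨ A, e₀, e₁, … ∣ m i · e i = γ i ⟩, i.e. (A ⊕ ℤ⁽ℕ⁾) modulo the
-- subgroup generated by the m i · e i − γ i.  A pair (x , c) stands for x + Σ c i · e i;
-- the Lift fields only raise universe levels.
module Presentation {a ℓa : Level} (A : AbelianGroup a ℓa) (λ′ : Level) (m : ℕ → ℕ)
                    (γ : ℕ → AbelianGroup.Carrier A) where
  private
    module A = AbelianGroup A
    module AP = Powers A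
  open Combination A
  open SetoidReasoning A.setoid

  record Elt : Set (a ⊔ λ′) where
    constructor elt′
    field
      base   : A.Carrier
      coeffs : FinSupp
      pad    : Lift λ′ ⊤
  open Elt public

  elt : A.Carrier → FinSupp → Elt
  elt x c = elt′ x c (lift tt)

  infix 4 _~_

  record _~_ (x y : Elt) : Set (ℓa ⊔ λ′) where
    constructor rel′
    field
      witness  : FinSupp
      coeff-eq : ∀ i → coeff (coeffs x) i ≡ coeff (coeffs y) i ℤ.+ + m i ℤ.* coeff witness i
      base-eq  : base y A.≈ base x A.∙ ⟪ γ ∣ witness ⟫
      pad~     : Lift λ′ ⊤

  rel : ∀ {x y} d → (∀ i → coeff (coeffs x) i ≡ coeff (coeffs y) i ℤ.+ + m i ℤ.* coeff d i) →
        base y A.≈ base x A.∙ ⟪ γ ∣ d ⟫ → x ~ y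
  rel d p q = rel′ d p q (lift tt)

  ~-by-≡ : ∀ {x y} → (∀ i → coeff (coeffs x) i ≡ coeff (coeffs y) i) → base y A.≈ base x → x ~ y
  ~-by-≡ {x} {y} p q = rel 0ᶠ (λ i → Eq.trans (p i) (Eq.sym (lemma (coeff (coeffs y) i) (+ m i))))
                             (A.trans q (A.sym (A.identityʳ _)))
    where
      lemma : ∀ c k → c ℤ.+ k ℤ.* 0ℤ ≡ c
      lemma = solve-∀

  infixl 6 _+ᴾ_

  _+ᴾ_ : Elt → Elt → Elt
  x +ᴾ y = elt (base x A.∙ base y) (coeffs x ⊕ coeffs y)

  -ᴾ_ : Elt → Elt
  -ᴾ x = elt (base x A.⁻¹) (⊝ coeffs x)

  0ᴾ : Elt
  0ᴾ = elt A.ε 0ᶠ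

  ~-refl : ∀ {x} → x ~ x
  ~-refl = ~-by-≡ (λ _ → Eq.refl) A.refl

  ~-sym : ∀ {x y} → x ~ y → y ~ x
  ~-sym {x} {y} (rel′ d p q _) = rel (⊝ d) (λ i → lemma (coeff (coeffs y) i) (+ m i) (coeff d i) (p i)) (begin
    base x                               ≈⟨ A.sym (A.identityʳ _) ⟩
    base x A.∙ A.ε                       ≈⟨ A.∙-cong A.refl (A.sym (A.inverseʳ _)) ⟩
    base x A.∙ (⟪ γ ∣ d ⟫ A.∙ ⟪ γ ∣ d ⟫ A.⁻¹) ≈⟨ A.sym (A.assoc _ _ _) ⟩
    (base x A.∙ ⟪ γ ∣ d ⟫) A.∙ ⟪ γ ∣ d ⟫ A.⁻¹ ≈⟨ A.∙-cong (A.sym q) (A.sym (⟪⟫-⊝ γ d)) ⟩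
    base y A.∙ ⟪ γ ∣ ⊝ d ⟫              ∎)
    where
      lemma : ∀ {c} c′ k d → c ≡ c′ ℤ.+ k ℤ.* d → c′ ≡ c ℤ.+ k ℤ.* ℤ.- d
      lemma c′ k d Eq.refl = solve-∀′ c′ k d
        where
          solve-∀′ : ∀ c′ k d → c′ ≡ (c′ ℤ.+ k ℤ.* d) ℤ.+ k ℤ.* ℤ.- d
          solve-∀′ = solve-∀

  ~-trans : ∀ {x y z} → x ~ y → y ~ z → x ~ z
  ~-trans {x} {y} {z} (rel′ d p q _) (rel′ d′ p′ q′ _) =
    rel (d ⊕ d′) (λ i → lemma (coeff (coeffs z) i) (+ m i) (coeff d i) (coeff d′ i) (p i) (p′ i)) (begin
      base z                                  ≈⟨ q′ ⟩
      base y A.∙ ⟪ γ ∣ d′ ⟫                   ≈⟨ A.∙-cong q A.refl ⟩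
      (base x A.∙ ⟪ γ ∣ d ⟫) A.∙ ⟪ γ ∣ d′ ⟫   ≈⟨ A.assoc _ _ _ ⟩
      base x A.∙ (⟪ γ ∣ d ⟫ A.∙ ⟪ γ ∣ d′ ⟫)   ≈⟨ A.∙-cong A.refl (A.sym (⟪⟫-⊕ γ d d′)) ⟩
      base x A.∙ ⟪ γ ∣ d ⊕ d′ ⟫               ∎)
    where
      lemma : ∀ {c c′} c″ k d d′ → c ≡ c′ ℤ.+ k ℤ.* d → c′ ≡ c″ ℤ.+ k ℤ.* d′ → c ≡ c″ ℤ.+ k ℤ.* (d ℤ.+ d′)
      lemma c″ k d d′ Eq.refl Eq.refl = identity c″ k d d′
        where
          identity : ∀ c″ k d d′ → (c″ ℤ.+ k ℤ.* d′) ℤ.+ k ℤ.* d ≡ c″ ℤ.+ k ℤ.* (d ℤ.+ d′)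
          identity = solve-∀

  +ᴾ-cong : ∀ {x x′ y y′} → x ~ x′ → y ~ y′ → (x +ᴾ y) ~ (x′ +ᴾ y′)
  +ᴾ-cong {x} {x′} {y} {y′} (rel′ d p q _) (rel′ d′ p′ q′ _) =
    rel (d ⊕ d′) (λ i → lemma (coeff (coeffs x′) i) (coeff (coeffs y′) i) (+ m i) (coeff d i) (coeff d′ i) (p i) (p′ i)) (begin
      base x′ A.∙ base y′                                 ≈⟨ A.∙-cong q q′ ⟩
      (base x A.∙ ⟪ γ ∣ d ⟫) A.∙ (base y A.∙ ⟪ γ ∣ d′ ⟫)  ≈⟨ AP.interchange _ _ _ _ ⟩
      (base x A.∙ base y) A.∙ (⟪ γ ∣ d ⟫ A.∙ ⟪ γ ∣ d′ ⟫)  ≈⟨ A.∙-cong A.refl (A.sym (⟪⟫-⊕ γ d d′)) ⟩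
      (base x A.∙ base y) A.∙ ⟪ γ ∣ d ⊕ d′ ⟫              ∎)
    where
      lemma : ∀ {c e} c′ e′ k d d′ → c ≡ c′ ℤ.+ k ℤ.* d → e ≡ e′ ℤ.+ k ℤ.* d′ →
              c ℤ.+ e ≡ (c′ ℤ.+ e′) ℤ.+ k ℤ.* (d ℤ.+ d′)
      lemma c′ e′ k d d′ Eq.refl Eq.refl = identity c′ e′ k d d′
        where
          identity : ∀ c′ e′ k d d′ → (c′ ℤ.+ k ℤ.* d) ℤ.+ (e′ ℤ.+ k ℤ.* d′) ≡ (c′ ℤ.+ e′) ℤ.+ k ℤ.* (d ℤ.+ d′)
          identity = solve-∀

  -ᴾ-cong : ∀ {x y} → x ~ y → (-ᴾ x) ~ (-ᴾ y)
  -ᴾ-cong {x} {y} (rel′ d p q _) = rel (⊝ d) (λ i → lemma (coeff (coeffs y) i) (+ m i) (coeff d i) (p i)) (begin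
    base y A.⁻¹                           ≈⟨ A.⁻¹-cong q ⟩
    (base x A.∙ ⟪ γ ∣ d ⟫) A.⁻¹           ≈⟨ A.sym (AP.⁻¹-∙-comm _ _) ⟩
    base x A.⁻¹ A.∙ ⟪ γ ∣ d ⟫ A.⁻¹        ≈⟨ A.∙-cong A.refl (A.sym (⟪⟫-⊝ γ d)) ⟩
    base x A.⁻¹ A.∙ ⟪ γ ∣ ⊝ d ⟫           ∎)
    where
      lemma : ∀ {c} c′ k d → c ≡ c′ ℤ.+ k ℤ.* d → ℤ.- c ≡ ℤ.- c′ ℤ.+ k ℤ.* ℤ.- d
      lemma c′ k d Eq.refl = identity c′ k d
        where
          identity : ∀ c′ k d → ℤ.- (c′ ℤ.+ k ℤ.* d) ≡ ℤ.- c′ ℤ.+ k ℤ.* ℤ.- d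
          identity = solve-∀

  isAbelianGroup : IsAbelianGroup _~_ _+ᴾ_ 0ᴾ -ᴾ_
  isAbelianGroup = record
    { isGroup = record
      { isMonoid = record
        { isSemigroup = record
          { isMagma = record
            { isEquivalence = record { refl = ~-refl ; sym = ~-sym ; trans = ~-trans }
            ; ∙-cong = +ᴾ-cong }
          ; assoc = λ x y z → ~-by-≡ (λ i → ℤP.+-assoc (coeff (coeffs x) i) _ _) (A.sym (A.assoc _ _ _)) }
        ; identity = (λ x → ~-by-≡ (λ i → ℤP.+-identityˡ _) (A.sym (A.identityˡ _)))
                   , (λ x → ~-by-≡ (λ i → ℤP.+-identityʳ _) (A.sym (A.identityʳ _))) }
      ; inverse = (λ x → ~-by-≡ (λ i → ℤP.+-inverseˡ (coeff (coeffs x) i)) (A.sym (A.inverseˡ _)))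
                , (λ x → ~-by-≡ (λ i → ℤP.+-inverseʳ (coeff (coeffs x) i)) (A.sym (A.inverseʳ _)))
      ; ⁻¹-cong = -ᴾ-cong }
    ; comm = λ x y → ~-by-≡ (λ i → ℤP.+-comm (coeff (coeffs x) i) _) (A.comm _ _) }

  Presented : AbelianGroup (a ⊔ λ′) (ℓa ⊔ λ′)
  Presented = record { isAbelianGroup = isAbelianGroup }

  ι : A.Carrier → Elt
  ι x = elt x 0ᶠ

  ι-cong : ∀ {x y} → x A.≈ y → ι x ~ ι y
  ι-cong x≈y = ~-by-≡ (λ _ → Eq.refl) (A.sym x≈y)

  ι-homo : ∀ x y → ι (x A.∙ y) ~ (ι x +ᴾ ι y)
  ι-homo x y = ~-by-≡ (λ _ → Eq.refl) A.refl

  ι-injective : (∀ i → NonZero (m i)) → ∀ {x y} → ι x ~ ι y → x A.≈ y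
  ι-injective m≢0 (rel′ d 0≡m·d base-eq _) = A.sym (A.trans base-eq (A.trans (A.∙-cong A.refl ⟪γ∣d⟫≈ε) (A.identityʳ _)))
    where
      d≡0 : ∀ i → coeff d i ≡ 0ℤ
      d≡0 i with ℤP.i*j≡0⇒i≡0∨j≡0 (+ m i) (Eq.sym (Eq.trans (0≡m·d i) (ℤP.+-identityˡ _)))
      ... | inj₂ d≡0 = d≡0
      ... | inj₁ m≡0 = ⊥-elim (ℕ.≢-nonZero⁻¹ (m i) {{m≢0 i}} (ℤP.+-injective m≡0))
      ⟪γ∣d⟫≈ε : ⟪ γ ∣ d ⟫ A.≈ A.ε
      ⟪γ∣d⟫≈ε = AP.∑<-ε (bd d) (λ i _ → ·ℤ-0 (γ i) (d≡0 i))

  ·-elt : ∀ k x → Powers._·_ Presented k x ~ elt (k AP.· base x) (+ k ⊛ coeffs x)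
  ·-elt zero    x = ~-by-≡ (λ j → Eq.sym (ℤP.*-zeroˡ (coeff (coeffs x) j))) A.refl
  ·-elt (suc k) x = ~-trans (+ᴾ-cong (~-refl {x}) (·-elt k x))
                            (~-by-≡ (λ j → suc-* k (coeff (coeffs x) j)) A.refl)
    where
      suc-* : ∀ k z → z ℤ.+ + k ℤ.* z ≡ + suc k ℤ.* z
      suc-* k z = Eq.trans (lemma (+ k) z) (Eq.cong (ℤ._* z) (Eq.sym (ℤP.pos-+ 1 k)))
        where
          lemma : ∀ k z → z ℤ.+ k ℤ.* z ≡ (+ 1 ℤ.+ k) ℤ.* z
          lemma = solve-∀

-- Changing the relations

module ℤ-Sums = Powers ℤP.+-0-abelianGroup using (∑<; ∑<-cong; ∑<-cong<; ∑<-ε; ∑<-extend; ∑<-distrib-∙; ∑<-⁻¹)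
open ℤ-Sums using () renaming (∑< to ∑ℤ)

∑ℤ-*ˡ : ∀ N k f → ∑ℤ N (λ i → k ℤ.* f i) ≡ k ℤ.* ∑ℤ N f
∑ℤ-*ˡ zero    k f = Eq.sym (ℤP.*-zeroʳ k)
∑ℤ-*ˡ (suc N) k f = Eq.trans (Eq.cong (ℤ._+ k ℤ.* f N) (∑ℤ-*ˡ N k f)) (Eq.sym (ℤP.*-distribˡ-+ k (∑ℤ N f) (f N)))

module _ {a ℓa : Level} (G : AbelianGroup a ℓa) where
  open AbelianGroup G
  open Powers G

  ∑ℤ-·ℤ : ∀ N f x → ∑ℤ N f ·ℤ x ≈ ∑< N (λ i → f i ·ℤ x)
  ∑ℤ-·ℤ zero    f x = refl
  ∑ℤ-·ℤ (suc N) f x = trans (·ℤ-distribʳ-+ (∑ℤ N f) (f N) x) (∙-cong (∑ℤ-·ℤ N f x) refl)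

infixl 7 _⋆_

_⋆_ : FinSupp → (ℕ → FinSupp) → FinSupp
c ⋆ r = mkFinSupp (λ j → ∑ℤ (bd c) (λ i → coeff c i ℤ.* coeff (r i) j)) (max< (bd c) (λ i → bd (r i)))
  (λ j bd≤j → ℤ-Sums.∑<-ε (bd c) (λ i i<bd →
     Eq.trans (Eq.cong (coeff c i ℤ.*_) (beyond-bd (r i) j (ℕP.≤-trans (≤-max< (bd c) (λ i → bd (r i)) i i<bd) bd≤j)))
              (ℤP.*-zeroʳ (coeff c i))))

⋆-extend : ∀ c r N → bd c ≤ N → ∀ j → coeff (c ⋆ r) j ≡ ∑ℤ N (λ i → coeff c i ℤ.* coeff (r i) j)
⋆-extend c r N bd≤N j = Eq.sym (ℤ-Sums.∑<-extend (bd c) N _ bd≤N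
  (λ i bd≤i → Eq.cong (ℤ._* coeff (r i) j) (beyond-bd c i bd≤i)))

⋆-distribʳ-⊕ : ∀ c c′ r j → coeff ((c ⊕ c′) ⋆ r) j ≡ coeff (c ⋆ r) j ℤ.+ coeff (c′ ⋆ r) j
⋆-distribʳ-⊕ c c′ r j = begin
  coeff ((c ⊕ c′) ⋆ r) j                                                  ≡⟨ ⋆-extend (c ⊕ c′) r N ℕP.≤-refl j ⟩
  ∑ℤ N (λ i → (coeff c i ℤ.+ coeff c′ i) ℤ.* coeff (r i) j)               ≡⟨ ℤ-Sums.∑<-cong N (λ i → ℤP.*-distribʳ-+ (coeff (r i) j) (coeff c i) (coeff c′ i)) ⟩
  ∑ℤ N (λ i → coeff c i ℤ.* coeff (r i) j ℤ.+ coeff c′ i ℤ.* coeff (r i) j) ≡⟨ ℤ-Sums.∑<-distrib-∙ N _ _ ⟩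
  ∑ℤ N (λ i → coeff c i ℤ.* coeff (r i) j) ℤ.+ ∑ℤ N (λ i → coeff c′ i ℤ.* coeff (r i) j)
      ≡⟨ Eq.cong₂ ℤ._+_ (⋆-extend c r N (ℕP.m≤m⊔n _ _) j) (⋆-extend c′ r N (ℕP.m≤n⊔m _ _) j) ⟨
  coeff (c ⋆ r) j ℤ.+ coeff (c′ ⋆ r) j                                    ∎
  where
    open Eq.≡-Reasoning
    N : ℕ
    N = bd c ⊔ℕ bd c′

RowOrColumnZero : (ℕ → FinSupp) → Set
RowOrColumnZero r = ∀ i → (∀ j → coeff (r i) j ≡ 0ℤ) ⊎ (∀ k → coeff (r k) i ≡ 0ℤ)

-- Such an r squares to zero, so c ↦ c ⊕ c ⋆ r is inverted by c ↦ c ⊕ c ⋆ (− r).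
⋆-square-zero : ∀ r → RowOrColumnZero r → ∀ c i j → coeff (c ⋆ r) i ℤ.* coeff (r i) j ≡ 0ℤ
⋆-square-zero r zero-row-or-column c i j with zero-row-or-column i
... | inj₁ row-zero    = Eq.trans (Eq.cong (coeff (c ⋆ r) i ℤ.*_) (row-zero j)) (ℤP.*-zeroʳ (coeff (c ⋆ r) i))
... | inj₂ column-zero = Eq.cong (ℤ._* coeff (r i) j) (ℤ-Sums.∑<-ε (bd c)
        (λ k _ → Eq.trans (Eq.cong (coeff c k ℤ.*_) (column-zero k)) (ℤP.*-zeroʳ (coeff c k))))

⋆-unipotent-inverse : ∀ r r′ → RowOrColumnZero r → (∀ i j → coeff (r′ i) j ≡ ℤ.- coeff (r i) j) →
                      ∀ c j → coeff ((c ⊕ c ⋆ r) ⊕ (c ⊕ c ⋆ r) ⋆ r′) j ≡ coeff c j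
⋆-unipotent-inverse r r′ zero-row-or-column r′≡-r c j =
  Eq.trans (Eq.cong (λ w → coeff c j ℤ.+ coeff (c ⋆ r) j ℤ.+ w) correction) (cancel (coeff c j) (coeff (c ⋆ r) j))
  where
    open Eq.≡-Reasoning
    cancel : ∀ x y → x ℤ.+ y ℤ.+ ℤ.- y ≡ x
    cancel = solve-∀
    N : ℕ
    N = bd c ⊔ℕ max< (bd c) (λ i → bd (r i))
    term : ∀ i → (coeff c i ℤ.+ coeff (c ⋆ r) i) ℤ.* coeff (r′ i) j ≡ ℤ.- (coeff c i ℤ.* coeff (r i) j)
    term i = begin
      (coeff c i ℤ.+ coeff (c ⋆ r) i) ℤ.* coeff (r′ i) j                       ≡⟨ Eq.cong ((coeff c i ℤ.+ coeff (c ⋆ r) i) ℤ.*_) (r′≡-r i j) ⟩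
      (coeff c i ℤ.+ coeff (c ⋆ r) i) ℤ.* ℤ.- coeff (r i) j                    ≡⟨ ℤP.neg-distribʳ-* (coeff c i ℤ.+ coeff (c ⋆ r) i) (coeff (r i) j) ⟨
      ℤ.- ((coeff c i ℤ.+ coeff (c ⋆ r) i) ℤ.* coeff (r i) j)                  ≡⟨ Eq.cong ℤ.-_ (ℤP.*-distribʳ-+ (coeff (r i) j) (coeff c i) (coeff (c ⋆ r) i)) ⟩
      ℤ.- (coeff c i ℤ.* coeff (r i) j ℤ.+ coeff (c ⋆ r) i ℤ.* coeff (r i) j)  ≡⟨ Eq.cong (λ w → ℤ.- (coeff c i ℤ.* coeff (r i) j ℤ.+ w)) (⋆-square-zero r zero-row-or-column c i j) ⟩
      ℤ.- (coeff c i ℤ.* coeff (r i) j ℤ.+ 0ℤ)                                 ≡⟨ Eq.cong ℤ.-_ (ℤP.+-identityʳ _) ⟩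
      ℤ.- (coeff c i ℤ.* coeff (r i) j)                                        ∎
    correction : coeff ((c ⊕ c ⋆ r) ⋆ r′) j ≡ ℤ.- coeff (c ⋆ r) j
    correction = begin
      coeff ((c ⊕ c ⋆ r) ⋆ r′) j                                ≡⟨ ⋆-extend (c ⊕ c ⋆ r) r′ N ℕP.≤-refl j ⟩
      ∑ℤ N (λ i → (coeff c i ℤ.+ coeff (c ⋆ r) i) ℤ.* coeff (r′ i) j) ≡⟨ ℤ-Sums.∑<-cong N term ⟩
      ∑ℤ N (λ i → ℤ.- (coeff c i ℤ.* coeff (r i) j))            ≡⟨ ℤ-Sums.∑<-⁻¹ N _ ⟩
      ℤ.- ∑ℤ N (λ i → coeff c i ℤ.* coeff (r i) j)              ≡⟨ Eq.cong ℤ.-_ (⋆-extend c r N (ℕP.m≤m⊔n _ _) j) ⟨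
      ℤ.- coeff (c ⋆ r) j                                       ∎

-- Replacing the relations m i · e i = γ i by m i · e i = γ′ i: the substitution
-- e i ↦ e i + Σ j (r i j) e j respects the relations as soon as m i · r i j = m j · E i j
-- and γ i = γ′ i + ⟪ γ′ ∣ E i ⟫.
module RelationChange {a ℓa : Level} (A : AbelianGroup a ℓa) (λ′ : Level) (m : ℕ → ℕ)
  (γ γ′ : ℕ → AbelianGroup.Carrier A) (r E : ℕ → FinSupp)
  (m·r≡m·E : ∀ i j → + m i ℤ.* coeff (r i) j ≡ + m j ℤ.* coeff (E i) j)
  (γ≈γ′+⟪γ′∣E⟫ : ∀ i → AbelianGroup._≈_ A (γ i) (AbelianGroup._∙_ A (γ′ i) (Combination.⟪_∣_⟫ A γ′ (E i))))
  where
  private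
    module A = AbelianGroup A
    module AP = Powers A
    module S = Presentation A λ′ m γ
    module T = Presentation A λ′ m γ′
  open Combination A using (⟪_∣_⟫; ⟪⟫-⊕; ⟪⟫-extend)

  φ : S.Elt → T.Elt
  φ x = T.elt (S.base x) (S.coeffs x ⊕ S.coeffs x ⋆ r)

  φ-homo : ∀ x y → φ (x S.+ᴾ y) T.~ (φ x T.+ᴾ φ y)
  φ-homo x y = T.~-by-≡ (λ j → Eq.trans (Eq.cong (λ w → (coeff c j ℤ.+ coeff c′ j) ℤ.+ w) (⋆-distribʳ-⊕ c c′ r j))
                                         (reorder (coeff c j) (coeff c′ j) (coeff (c ⋆ r) j) (coeff (c′ ⋆ r) j)))
                        A.refl
    where
      c c′ : FinSupp
      c = S.coeffs x
      c′ = S.coeffs y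
      reorder : ∀ p q u v → (p ℤ.+ q) ℤ.+ (u ℤ.+ v) ≡ (p ℤ.+ u) ℤ.+ (q ℤ.+ v)
      reorder = solve-∀

  ⟪γ∣d⟫≈⟪γ′∣d⊕d⋆E⟫ : ∀ d → ⟪ γ ∣ d ⟫ A.≈ ⟪ γ′ ∣ d ⊕ d ⋆ E ⟫
  ⟪γ∣d⟫≈⟪γ′∣d⊕d⋆E⟫ d = begin
    ⟪ γ ∣ d ⟫                                                  ≈⟨ AP.∑<-cong (bd d) (λ i → A.trans (AP.·ℤ-cong (coeff d i) (γ≈γ′+⟪γ′∣E⟫ i)) (AP.·ℤ-distribˡ-∙ (coeff d i) _ _)) ⟩
    AP.∑< (bd d) (λ i → coeff d i AP.·ℤ γ′ i A.∙ coeff d i AP.·ℤ ⟪ γ′ ∣ E i ⟫) ≈⟨ AP.∑<-distrib-∙ (bd d) _ _ ⟩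
    ⟪ γ′ ∣ d ⟫ A.∙ AP.∑< (bd d) (λ i → coeff d i AP.·ℤ ⟪ γ′ ∣ E i ⟫)          ≈⟨ A.∙-cong A.refl (A.sym ⟪γ′∣d⋆E⟫) ⟩
    ⟪ γ′ ∣ d ⟫ A.∙ ⟪ γ′ ∣ d ⋆ E ⟫                              ≈⟨ A.sym (⟪⟫-⊕ γ′ d (d ⋆ E)) ⟩
    ⟪ γ′ ∣ d ⊕ d ⋆ E ⟫                                         ∎
    where
      open SetoidReasoning A.setoid
      N : ℕ
      N = bd (d ⋆ E)
      ⟪γ′∣d⋆E⟫ : ⟪ γ′ ∣ d ⋆ E ⟫ A.≈ AP.∑< (bd d) (λ i → coeff d i AP.·ℤ ⟪ γ′ ∣ E i ⟫)
      ⟪γ′∣d⋆E⟫ = begin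
        AP.∑< N (λ j → ∑ℤ (bd d) (λ i → coeff d i ℤ.* coeff (E i) j) AP.·ℤ γ′ j)   ≈⟨ AP.∑<-cong N (λ j → ∑ℤ-·ℤ A (bd d) _ (γ′ j)) ⟩
        AP.∑< N (λ j → AP.∑< (bd d) (λ i → (coeff d i ℤ.* coeff (E i) j) AP.·ℤ γ′ j)) ≈⟨ A.sym (AP.∑<-swap (bd d) N _) ⟩
        AP.∑< (bd d) (λ i → AP.∑< N (λ j → (coeff d i ℤ.* coeff (E i) j) AP.·ℤ γ′ j)) ≈⟨ AP.∑<-cong< (bd d) row ⟩
        AP.∑< (bd d) (λ i → coeff d i AP.·ℤ ⟪ γ′ ∣ E i ⟫)                          ∎
        where
          row : ∀ i → i < bd d → AP.∑< N (λ j → (coeff d i ℤ.* coeff (E i) j) AP.·ℤ γ′ j) A.≈ coeff d i AP.·ℤ ⟪ γ′ ∣ E i ⟫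
          row i i<bd = A.trans (AP.∑<-cong N (λ j → AP.·ℤ-assoc (coeff d i) (coeff (E i) j) (γ′ j)))
            (A.trans (AP.∑<-·ℤ N (coeff d i) _)
                     (AP.·ℤ-cong (coeff d i) (⟪⟫-extend γ′ (E i) N (≤-max< (bd d) (λ i → bd (E i)) i i<bd))))

  φ-cong : ∀ {x y} → x S.~ y → φ x T.~ φ y
  φ-cong {x} {y} (S.rel′ d c≡c′+md base-eq _) =
    T.rel (d ⊕ d ⋆ E) coefficients (A.trans base-eq (A.∙-cong A.refl (⟪γ∣d⟫≈⟪γ′∣d⊕d⋆E⟫ d)))
    where
      open Eq.≡-Reasoning
      c c′ : FinSupp
      c = S.coeffs x
      c′ = S.coeffs y
      N : ℕ
      N = (bd c ⊔ℕ bd c′) ⊔ℕ bd d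
      term : ∀ j i → coeff c i ℤ.* coeff (r i) j ≡ coeff c′ i ℤ.* coeff (r i) j ℤ.+ + m j ℤ.* (coeff d i ℤ.* coeff (E i) j)
      term j i = begin
        coeff c i ℤ.* coeff (r i) j                                          ≡⟨ Eq.cong (ℤ._* coeff (r i) j) (c≡c′+md i) ⟩
        (coeff c′ i ℤ.+ + m i ℤ.* coeff d i) ℤ.* coeff (r i) j               ≡⟨ expand (coeff c′ i) (+ m i) (coeff d i) (coeff (r i) j) ⟩
        coeff c′ i ℤ.* coeff (r i) j ℤ.+ coeff d i ℤ.* (+ m i ℤ.* coeff (r i) j) ≡⟨ Eq.cong (λ w → coeff c′ i ℤ.* coeff (r i) j ℤ.+ coeff d i ℤ.* w) (m·r≡m·E i j) ⟩
        coeff c′ i ℤ.* coeff (r i) j ℤ.+ coeff d i ℤ.* (+ m j ℤ.* coeff (E i) j) ≡⟨ Eq.cong (λ w → coeff c′ i ℤ.* coeff (r i) j ℤ.+ w) (swap (coeff d i) (+ m j) (coeff (E i) j)) ⟩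
        coeff c′ i ℤ.* coeff (r i) j ℤ.+ + m j ℤ.* (coeff d i ℤ.* coeff (E i) j) ∎
        where
          expand : ∀ c′ k d r → (c′ ℤ.+ k ℤ.* d) ℤ.* r ≡ c′ ℤ.* r ℤ.+ d ℤ.* (k ℤ.* r)
          expand = solve-∀
          swap : ∀ d k e → d ℤ.* (k ℤ.* e) ≡ k ℤ.* (d ℤ.* e)
          swap = solve-∀
      c⋆r : ∀ j → coeff (c ⋆ r) j ≡ coeff (c′ ⋆ r) j ℤ.+ + m j ℤ.* coeff (d ⋆ E) j
      c⋆r j = begin
        coeff (c ⋆ r) j                                                  ≡⟨ ⋆-extend c r N (ℕP.≤-trans (ℕP.m≤m⊔n (bd c) (bd c′)) (ℕP.m≤m⊔n _ (bd d))) j ⟩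
        ∑ℤ N (λ i → coeff c i ℤ.* coeff (r i) j)                        ≡⟨ ℤ-Sums.∑<-cong N (term j) ⟩
        ∑ℤ N (λ i → coeff c′ i ℤ.* coeff (r i) j ℤ.+ + m j ℤ.* (coeff d i ℤ.* coeff (E i) j)) ≡⟨ ℤ-Sums.∑<-distrib-∙ N _ _ ⟩
        ∑ℤ N (λ i → coeff c′ i ℤ.* coeff (r i) j) ℤ.+ ∑ℤ N (λ i → + m j ℤ.* (coeff d i ℤ.* coeff (E i) j))
            ≡⟨ Eq.cong₂ ℤ._+_ (⋆-extend c′ r N (ℕP.≤-trans (ℕP.m≤n⊔m (bd c) (bd c′)) (ℕP.m≤m⊔n _ (bd d))) j)
                               (Eq.trans (Eq.cong (+ m j ℤ.*_) (⋆-extend d E N (ℕP.m≤n⊔m _ (bd d)) j)) (Eq.sym (∑ℤ-*ˡ N (+ m j) _))) ⟨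
        coeff (c′ ⋆ r) j ℤ.+ + m j ℤ.* coeff (d ⋆ E) j                 ∎
      coefficients : ∀ j → coeff (c ⊕ c ⋆ r) j ≡ coeff (c′ ⊕ c′ ⋆ r) j ℤ.+ + m j ℤ.* coeff (d ⊕ d ⋆ E) j
      coefficients j = Eq.trans (Eq.cong₂ ℤ._+_ (c≡c′+md j) (c⋆r j))
        (regroup (coeff c′ j) (+ m j) (coeff d j) (coeff (c′ ⋆ r) j) (coeff (d ⋆ E) j))
        where
          regroup : ∀ c′ k d s t → (c′ ℤ.+ k ℤ.* d) ℤ.+ (s ℤ.+ k ℤ.* t) ≡ (c′ ℤ.+ s) ℤ.+ k ℤ.* (d ℤ.+ t)
          regroup = solve-∀

module _ {a ℓa : Level} (A : AbelianGroup a ℓa) (λ′ : Level) (m : ℕ → ℕ) where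
  private
    module A = AbelianGroup A
    module AC = Combination A
    module P γ = Presentation A λ′ m γ

  relationChange-bijective : ∀ γ γ′ r E → RowOrColumnZero r →
    (∀ i j → + m i ℤ.* coeff (r i) j ≡ + m j ℤ.* coeff (E i) j) →
    (∀ i → γ i A.≈ γ′ i A.∙ AC.⟪ γ′ ∣ E i ⟫) →
    (∀ i → AC.⟪ γ ∣ E i ⟫ A.≈ AC.⟪ γ′ ∣ E i ⟫) →
    BijectiveHom (P.Presented γ) (P.Presented γ′)
  relationChange-bijective γ γ′ r E r-zero m·r≡m·E γ≈γ′+⟪γ′∣E⟫ ⟪γ∣E⟫≈⟪γ′∣E⟫ = record
    { to        = F.φ
    ; cong      = F.φ-cong
    ; homo      = F.φ-homo
    ; injective = λ {x} {y} p → P.~-trans γ (P.~-sym γ (back∘forth x)) (P.~-trans γ (B.φ-cong p) (back∘forth y))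
    ; section   = λ y → B.φ y , forth∘back y }
    where
      -r : ℕ → FinSupp
      -r i = ⊝ r i
      -E : ℕ → FinSupp
      -E i = ⊝ E i
      m·-r≡m·-E : ∀ i j → + m i ℤ.* coeff (-r i) j ≡ + m j ℤ.* coeff (-E i) j
      m·-r≡m·-E i j = Eq.trans (Eq.sym (ℤP.neg-distribʳ-* (+ m i) (coeff (r i) j)))
        (Eq.trans (Eq.cong ℤ.-_ (m·r≡m·E i j)) (ℤP.neg-distribʳ-* (+ m j) (coeff (E i) j)))
      γ′≈γ+⟪γ∣-E⟫ : ∀ i → γ′ i A.≈ γ i A.∙ AC.⟪ γ ∣ -E i ⟫
      γ′≈γ+⟪γ∣-E⟫ i = A.sym (begin
        γ i A.∙ AC.⟪ γ ∣ -E i ⟫                               ≈⟨ A.∙-cong (γ≈γ′+⟪γ′∣E⟫ i) (A.trans (AC.⟪⟫-⊝ γ (E i)) (A.⁻¹-cong (⟪γ∣E⟫≈⟪γ′∣E⟫ i))) ⟩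
        (γ′ i A.∙ AC.⟪ γ′ ∣ E i ⟫) A.∙ AC.⟪ γ′ ∣ E i ⟫ A.⁻¹  ≈⟨ A.assoc _ _ _ ⟩
        γ′ i A.∙ (AC.⟪ γ′ ∣ E i ⟫ A.∙ AC.⟪ γ′ ∣ E i ⟫ A.⁻¹)  ≈⟨ A.∙-cong A.refl (A.inverseʳ _) ⟩
        γ′ i A.∙ A.ε                                          ≈⟨ A.identityʳ _ ⟩
        γ′ i                                                  ∎)
        where open SetoidReasoning A.setoid
      -r-zero : RowOrColumnZero -r
      -r-zero i with r-zero i
      ... | inj₁ row-zero    = inj₁ (λ j → Eq.cong ℤ.-_ (row-zero j))
      ... | inj₂ column-zero = inj₂ (λ k → Eq.cong ℤ.-_ (column-zero k))
      module F = RelationChange A λ′ m γ γ′ r E m·r≡m·E γ≈γ′+⟪γ′∣E⟫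
      module B = RelationChange A λ′ m γ′ γ -r -E m·-r≡m·-E γ′≈γ+⟪γ∣-E⟫
      back∘forth : ∀ x → P._~_ γ (B.φ (F.φ x)) x
      back∘forth x = P.~-by-≡ γ (⋆-unipotent-inverse r -r r-zero (λ _ _ → Eq.refl) (P.coeffs x)) A.refl
      forth∘back : ∀ y → P._~_ γ′ (F.φ (B.φ y)) y
      forth∘back y = P.~-by-≡ γ′
        (⋆-unipotent-inverse -r r -r-zero (λ i j → Eq.sym (ℤP.neg-involutive _)) (P.coeffs y)) A.refl

-- Extensions of ⊕ C by A

module Extensions (l : ℕ) (l-prime : Prime l) {γ₁ γ₂ : Level} (C : ℕ → AbelianGroup γ₁ γ₂)
            (C-cyclic : ∀ i → IsCyclic (C i)) (C-finite : ∀ i → IsFinite (C i))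
            (C-l-group : ∀ i → IsTorsionLGroup (C i) l)
            (C-unbounded : ∀ N → ∃ λ i → ∃ λ m → HasCard (C i) m × N < m)
            {α₁ α₂ : Level} (A : AbelianGroup α₁ α₂) (A-finite : IsFinite A) (A-l-group : IsTorsionLGroup A l) where
  open PrimePowers l l-prime public
  module C i = AbelianGroup (C i)
  module CP i = Powers (C i)
  module Cyc i = CyclicLGroup l l-prime (C i) (C-cyclic i) (C-finite i) (C-l-group i)
  module A = AbelianGroup A
  module AP = Powers A
  module AC = Combination A
  module D = AbelianGroup (⨁ C)
  module DS = DirectSum C
  module DP = Powers (⨁ C)
  module DC = Combination (⨁ C)
  open DirectSumCoordinates C public

  g : ∀ i → C.Carrier i
  g i = Cyc.generator i

  n : ℕ → ℕ
  n i = Cyc.exponent i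

  M : ℕ → ℤ
  M i = + (l ^ n i)

  n-unbounded : ∀ N → ∃ λ i → N ≤ n i
  n-unbounded N with C-unbounded (l ^ N)
  ... | i , m , card , l^N<m = i , ℕP.<⇒≤ (^-cancelʳ-< N (n i) (ℕP.<-≤-trans l^N<m (Cyc.card≤l^exponent i m card)))

  l^n·g≈ε : ∀ {N} j → n j ≤ N → C._≈_ j (CP._·_ j (l ^ N) (g j)) (C.ε j)
  l^n·g≈ε {N} j n≤N = begin
    (l ^ N) · g j                        ≡⟨ Eq.cong (_· g j) (l^-split (n j) N n≤N) ⟩
    (l ^ (N ∸ n j) * l ^ n j) · g j      ≈⟨ ·-assoc (l ^ (N ∸ n j)) (l ^ n j) (g j) ⟩
    (l ^ (N ∸ n j)) · (l ^ n j) · g j    ≈⟨ ·-cong (l ^ (N ∸ n j)) (Cyc.l^exponent·g≈ε j) ⟩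
    (l ^ (N ∸ n j)) · C.ε j              ≈⟨ ·-ε (l ^ (N ∸ n j)) ⟩
    C.ε j                                ∎
    where
      open Powers (C j)
      open SetoidReasoning (C.setoid j)

  M·ℤg≈ε : ∀ j z → C._≈_ j (CP._·ℤ_ j (M j ℤ.* z) (g j)) (C.ε j)
  M·ℤg≈ε j z = Eq.subst (λ w → C._≈_ j (CP._·ℤ_ j w (g j)) (C.ε j)) (ℤP.*-comm z (M j)) (Cyc.multiple·ℤg≈ε j z)

  A-size : ℕ
  A-size = proj₁ A-finite

  A-enum : Fin A-size → A.Carrier
  A-enum = proj₁ (proj₂ A-finite)

  A-enum-surj : ∀ x → ∃ λ t → A-enum t A.≈ x
  A-enum-surj = proj₂ (proj₂ (proj₂ A-finite))

  K : ℕ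
  K = maxFin A-size (λ t → proj₁ (A-l-group (A-enum t)))

  l^·A≈ε : ∀ {N} → K ≤ N → ∀ x → (l ^ N) AP.· x A.≈ A.ε
  l^·A≈ε {N} K≤N x = begin
    (l ^ N) · x                      ≈⟨ ·-cong (l ^ N) (A.sym (proj₂ (A-enum-surj x))) ⟩
    (l ^ N) · y                      ≡⟨ Eq.cong (_· y) (l^-split k N k≤N) ⟩
    (l ^ (N ∸ k) * l ^ k) · y        ≈⟨ ·-assoc (l ^ (N ∸ k)) (l ^ k) y ⟩
    (l ^ (N ∸ k)) · (l ^ k) · y      ≈⟨ ·-cong (l ^ (N ∸ k)) (proj₂ (A-l-group y)) ⟩
    (l ^ (N ∸ k)) · A.ε              ≈⟨ ·-ε (l ^ (N ∸ k)) ⟩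
    A.ε                              ∎
    where
      open AP
      open SetoidReasoning A.setoid
      t : Fin A-size
      t = proj₁ (A-enum-surj x)
      y : A.Carrier
      y = A-enum t
      k : ℕ
      k = proj₁ (A-l-group y)
      k≤N : k ≤ N
      k≤N = ℕP.≤-trans (≤-maxFin A-size (λ t → proj₁ (A-l-group (A-enum t))) t) K≤N

  l^·ℤA≈ε : ∀ {N} → K ≤ N → ∀ z x → (z ℤ.* + (l ^ N)) AP.·ℤ x A.≈ A.ε
  l^·ℤA≈ε {N} K≤N z x =
    A.trans (AP.·ℤ-assoc-+ z (l ^ N) x) (A.trans (AP.·ℤ-cong z (l^·A≈ε K≤N x)) (AP.·ℤ-ε z))

  TailsSpan : (ℕ → A.Carrier) → Set (α₁ ⊔ α₂)
  TailsSpan γ = ∀ k x → Σ FinSupp λ e → (∀ j → ¬ (coeff e j ≡ 0ℤ) → k ≤ n j) × (x A.≈ AC.⟪ γ ∣ e ⟫)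

  toSum : FinSupp → D.Carrier
  toSum c = DS.mkElt (λ j → CP._·ℤ_ j (coeff c j) (g j)) (bd c)
    (λ j bd≤j → Combination.·ℤ-0 (C j) (g j) (beyond-bd c j bd≤j))

  toSum-⊕ : ∀ c c′ → toSum (c ⊕ c′) D.≈ toSum c D.∙ toSum c′
  toSum-⊕ c c′ j = CP.·ℤ-distribʳ-+ j (coeff c j) (coeff c′ j) (g j)

  toSum-cong : ∀ {c c′} d → (∀ j → coeff c j ≡ coeff c′ j ℤ.+ M j ℤ.* coeff d j) → toSum c D.≈ toSum c′
  toSum-cong {c} {c′} d c≡c′+Md j = begin
    coeff c j ·ℤ g j                                   ≡⟨ Eq.cong (_·ℤ g j) (c≡c′+Md j) ⟩
    (coeff c′ j ℤ.+ M j ℤ.* coeff d j) ·ℤ g j          ≈⟨ ·ℤ-distribʳ-+ (coeff c′ j) _ (g j) ⟩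
    coeff c′ j ·ℤ g j ∙ (M j ℤ.* coeff d j) ·ℤ g j     ≈⟨ ∙-cong refl (M·ℤg≈ε j (coeff d j)) ⟩
    coeff c′ j ·ℤ g j ∙ ε                              ≈⟨ identityʳ _ ⟩
    coeff c′ j ·ℤ g j                                  ∎
    where
      open AbelianGroup (C j)
      open Powers (C j)
      open SetoidReasoning setoid

  toSum≈ε⇒l^n∣ : ∀ c → toSum c D.≈ D.ε → ∀ j → l ^ n j ∣ ℤ.∣ coeff c j ∣
  toSum≈ε⇒l^n∣ c c↦ε j = Cyc.·ℤg≈ε⇒l^exponent∣ j (coeff c j) (c↦ε j)

  coefficients : D.Carrier → FinSupp
  coefficients y = mkFinSupp coefficient (DS.bound y) beyond
    where
      coefficient : ℕ → ℤ
      coefficient j with j ℕ.<? DS.bound y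
      ... | yes _ = proj₁ (Cyc.generates j (DS.fn y j))
      ... | no  _ = 0ℤ
      beyond : ∀ j → DS.bound y ≤ j → coefficient j ≡ 0ℤ
      beyond j bd≤j with j ℕ.<? DS.bound y
      ... | yes j<bd = ⊥-elim (ℕP.<⇒≱ j<bd bd≤j)
      ... | no  _    = Eq.refl

  toSum-coefficients : ∀ y → toSum (coefficients y) D.≈ y
  toSum-coefficients y j with j ℕ.<? DS.bound y
  ... | yes _    = proj₂ (Cyc.generates j (DS.fn y j))
  ... | no  j≮bd = C.sym j (DS.supp y j (ℕP.≮⇒≥ j≮bd))

  infixl 7 _÷M _⊙M

  _÷M : FinSupp → FinSupp
  c ÷M = mkFinSupp (λ j → exactQuotient (coeff c j) (l ^ n j) {{l^-nonZero (n j)}}) (bd c)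
    (λ j bd≤j → Eq.trans (Eq.cong (λ z → exactQuotient z (l ^ n j) {{l^-nonZero (n j)}}) (beyond-bd c j bd≤j))
                         (exactQuotient-0 (l ^ n j) {{l^-nonZero (n j)}}))

  ÷M-correct : ∀ c → (∀ j → l ^ n j ∣ ℤ.∣ coeff c j ∣) → ∀ j → coeff c j ≡ M j ℤ.* coeff (c ÷M) j
  ÷M-correct c l^n∣c j = Eq.trans (exactQuotient-correct (coeff c j) (l ^ n j) {{l^-nonZero (n j)}} (l^n∣c j))
                                  (ℤP.*-comm _ (M j))

  _⊙M : FinSupp → FinSupp
  d ⊙M = mkFinSupp (λ i → M i ℤ.* coeff d i) (bd d)
    (λ i bd≤i → Eq.trans (Eq.cong (M i ℤ.*_) (beyond-bd d i bd≤i)) (ℤP.*-zeroʳ (M i)))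

  drop-small : ∀ k γ d → (∀ j → n j < k → coeff d j AP.·ℤ γ j A.≈ A.ε) →
               Σ FinSupp λ e → (∀ j → ¬ (coeff e j ≡ 0ℤ) → k ≤ n j) × (AC.⟪ γ ∣ d ⟫ A.≈ AC.⟪ γ ∣ e ⟫)
  drop-small k γ d small-vanish = e , e-support , AP.∑<-cong (bd d) term
    where
      kept : ℕ → ℤ
      kept j with k ℕ.≤? n j
      ... | yes _ = coeff d j
      ... | no  _ = 0ℤ
      e : FinSupp
      e = mkFinSupp kept (bd d) beyond
        where
          beyond : ∀ j → bd d ≤ j → kept j ≡ 0ℤ
          beyond j bd≤j with k ℕ.≤? n j
          ... | yes _ = beyond-bd d j bd≤j
          ... | no  _ = Eq.refl
      e-support : ∀ j → ¬ (kept j ≡ 0ℤ) → k ≤ n j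
      e-support j kept≢0 with k ℕ.≤? n j
      ... | yes k≤n = k≤n
      ... | no  _   = ⊥-elim (kept≢0 Eq.refl)
      term : ∀ j → coeff d j AP.·ℤ γ j A.≈ kept j AP.·ℤ γ j
      term j with k ℕ.≤? n j
      ... | yes _   = A.refl
      ... | no  k≰n = small-vanish j (ℕP.≰⇒> k≰n)

  -- With k = K + max n over the support of c: l ^ k · c j = M j · (c j · l ^ (k ∸ n j)), and
  -- K ≤ k ∸ n j makes every combination with the quotients vanish.
  l^⊛≡⊙M : ∀ c → Σ FinSupp λ d → (∀ j → + (l ^ (K + max< (bd c) n)) ℤ.* coeff c j ≡ M j ℤ.* coeff d j)
                                × (∀ γ → AC.⟪ γ ∣ d ⟫ A.≈ A.ε)
  l^⊛≡⊙M c = d , coefficients-eq , (λ γ → AP.∑<-ε (bd c) (term≈ε γ))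
    where
      N : ℕ
      N = max< (bd c) n
      k : ℕ
      k = K + N
      quotient : ℕ → ℤ
      quotient j with j ℕ.<? bd c
      ... | yes _ = coeff c j ℤ.* + (l ^ (k ∸ n j))
      ... | no  _ = 0ℤ
      d : FinSupp
      d = mkFinSupp quotient (bd c) beyond
        where
          beyond : ∀ j → bd c ≤ j → quotient j ≡ 0ℤ
          beyond j bd≤j with j ℕ.<? bd c
          ... | yes j<bd = ⊥-elim (ℕP.<⇒≱ j<bd bd≤j)
          ... | no  _    = Eq.refl
      coefficients-eq : ∀ j → + (l ^ k) ℤ.* coeff c j ≡ M j ℤ.* quotient j
      coefficients-eq j with j ℕ.<? bd c
      ... | yes j<bd = begin
        + (l ^ k) ℤ.* coeff c j                       ≡⟨ Eq.cong (λ m → + m ℤ.* coeff c j) (l^-split (n j) k n≤k) ⟩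
        + (l ^ (k ∸ n j) * l ^ n j) ℤ.* coeff c j     ≡⟨ Eq.cong (ℤ._* coeff c j) (ℤP.pos-* (l ^ (k ∸ n j)) (l ^ n j)) ⟩
        + (l ^ (k ∸ n j)) ℤ.* M j ℤ.* coeff c j       ≡⟨ reorder (+ (l ^ (k ∸ n j))) (M j) (coeff c j) ⟩
        M j ℤ.* (coeff c j ℤ.* + (l ^ (k ∸ n j)))     ∎
        where
          open Eq.≡-Reasoning
          n≤k : n j ≤ k
          n≤k = ℕP.≤-trans (≤-max< (bd c) n j j<bd) (ℕP.m≤n+m N K)
          reorder : ∀ p m c → p ℤ.* m ℤ.* c ≡ m ℤ.* (c ℤ.* p)
          reorder = solve-∀
      ... | no j≮bd = Eq.trans (Eq.cong (+ (l ^ k) ℤ.*_) (beyond-bd c j (ℕP.≮⇒≥ j≮bd)))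
                               (Eq.trans (ℤP.*-zeroʳ (+ (l ^ k))) (Eq.sym (ℤP.*-zeroʳ (M j))))
      term≈ε : ∀ γ j → j < bd c → quotient j AP.·ℤ γ j A.≈ A.ε
      term≈ε γ j j<bd with j ℕ.<? bd c
      ... | yes _    = l^·ℤA≈ε (ℕP.≤-trans (ℕP.m≤m+n K (N ∸ n j))
                         (ℕP.≤-reflexive (Eq.sym (ℕP.+-∸-assoc K (≤-max< (bd c) n j j<bd))))) (coeff c j) (γ j)
      ... | no  j≮bd = ⊥-elim (j≮bd j<bd)

  module SolutionIsPresented {ℓ₁ ℓ₂ : Level} (B : AbelianGroup ℓ₁ ℓ₂) (sol : IsSolution l A C B) where
    private
      module B  = AbelianGroup B
      module BP = Powers B
      module BC = Combination B
    open IsSolution sol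
    private
      module ι  = GroupMorphisms.IsGroupMonomorphism ι-mono
      module π  = GroupMorphisms.IsGroupHomomorphism π-hom
      module ιH = HomomorphismProperties A B ι ι.⟦⟧-cong ι.∙-homo
      module πH = HomomorphismProperties B (⨁ C) π π.⟦⟧-cong π.homo

    b : ℕ → B.Carrier
    b i = proj₁ (π-surj (inj i (g i)))

    π-b : ∀ i → π (b i) D.≈ inj i (g i)
    π-b i = proj₂ (π-surj (inj i (g i))) B.refl

    π-l^n·b : ∀ i → π ((l ^ n i) BP.· b i) D.≈ D.ε
    π-l^n·b i j = C.trans j (πH.h-· (l ^ n i) (b i) j)
      (C.trans j (DP.·-cong (l ^ n i) (π-b i) j) (·-inj≈ε (l ^ n i) i (g i) (l^n·g≈ε i ℕP.≤-refl) j))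

    α : ℕ → A.Carrier
    α i = proj₁ (proj₁ (exact ((l ^ n i) BP.· b i)) (π-l^n·b i))

    ι-α : ∀ i → ι (α i) B.≈ (l ^ n i) BP.· b i
    ι-α i = proj₂ (proj₁ (exact ((l ^ n i) BP.· b i)) (π-l^n·b i))

    open Presentation A Level.zero (λ i → l ^ n i) α hiding (ι; ι-cong; ι-homo; ι-injective)

    ⟪b∣⊙M⟫≈ι : ∀ d → BC.⟪ b ∣ d ⊙M ⟫ B.≈ ι AC.⟪ α ∣ d ⟫
    ⟪b∣⊙M⟫≈ι d = B.trans (BP.∑<-cong (bd d) term) (B.sym (ιH.h-⟪⟫ α d))
      where
        term : ∀ i → (M i ℤ.* coeff d i) BP.·ℤ b i B.≈ coeff d i BP.·ℤ ι (α i)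
        term i = begin
          (M i ℤ.* coeff d i) BP.·ℤ b i  ≡⟨ Eq.cong (BP._·ℤ b i) (ℤP.*-comm (M i) (coeff d i)) ⟩
          (coeff d i ℤ.* M i) BP.·ℤ b i  ≈⟨ BP.·ℤ-assoc-+ (coeff d i) (l ^ n i) (b i) ⟩
          coeff d i BP.·ℤ (l ^ n i) BP.· b i ≈⟨ BP.·ℤ-cong (coeff d i) (B.sym (ι-α i)) ⟩
          coeff d i BP.·ℤ ι (α i)        ∎
          where open SetoidReasoning B.setoid

    π⟪b⟫≈toSum : ∀ c → π BC.⟪ b ∣ c ⟫ D.≈ toSum c
    π⟪b⟫≈toSum c j = C.trans j (πH.h-⟪⟫ b c j)
      (C.trans j (DC.⟪⟫-cong {γ′ = λ i → inj i (g i)} c c π-b (λ _ → Eq.refl) j) (coord-⟪inj⟫ g c j))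

    π∘ι≈ε : ∀ x → π (ι x) D.≈ D.ε
    π∘ι≈ε x = proj₂ (exact (ι x)) (x , B.refl)

    ⟪b⟫≈ι⇒M∣ : ∀ c x → BC.⟪ b ∣ c ⟫ B.≈ ι x → ∀ j → coeff c j ≡ M j ℤ.* coeff (c ÷M) j
    ⟪b⟫≈ι⇒M∣ c x c↦x = ÷M-correct c (toSum≈ε⇒l^n∣ c (λ j →
      C.trans j (C.sym j (π⟪b⟫≈toSum c j)) (C.trans j (π.⟦⟧-cong c↦x j) (π∘ι≈ε x j))))

    ⟪b⟫≈ι⇒≈⟪α⟫ : ∀ c x → BC.⟪ b ∣ c ⟫ B.≈ ι x → x A.≈ AC.⟪ α ∣ c ÷M ⟫
    ⟪b⟫≈ι⇒≈⟪α⟫ c x c↦x = ι.injective (begin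
      ι x                       ≈⟨ B.sym c↦x ⟩
      BC.⟪ b ∣ c ⟫              ≈⟨ BC.⟪⟫-cong c ((c ÷M) ⊙M) (λ _ → B.refl) (⟪b⟫≈ι⇒M∣ c x c↦x) ⟩
      BC.⟪ b ∣ (c ÷M) ⊙M ⟫      ≈⟨ ⟪b∣⊙M⟫≈ι (c ÷M) ⟩
      ι AC.⟪ α ∣ c ÷M ⟫         ∎)
      where open SetoidReasoning B.setoid

    Φ : Elt → B.Carrier
    Φ x = ι (base x) B.∙ BC.⟪ b ∣ coeffs x ⟫

    Φ-cong : ∀ {x y} → x ~ y → Φ x B.≈ Φ y
    Φ-cong {x} {y} (rel′ d c≡c′+Md q _) = begin
      ι (base x) B.∙ BC.⟪ b ∣ coeffs x ⟫                            ≈⟨ B.∙-cong B.refl (BC.⟪⟫-cong (coeffs x) (coeffs y ⊕ d ⊙M) (λ _ → B.refl) c≡c′+Md) ⟩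
      ι (base x) B.∙ BC.⟪ b ∣ coeffs y ⊕ d ⊙M ⟫                     ≈⟨ B.∙-cong B.refl (BC.⟪⟫-⊕ b (coeffs y) (d ⊙M)) ⟩
      ι (base x) B.∙ (BC.⟪ b ∣ coeffs y ⟫ B.∙ BC.⟪ b ∣ d ⊙M ⟫)      ≈⟨ B.∙-cong B.refl (B.∙-cong B.refl (⟪b∣⊙M⟫≈ι d)) ⟩
      ι (base x) B.∙ (BC.⟪ b ∣ coeffs y ⟫ B.∙ ι AC.⟪ α ∣ d ⟫)       ≈⟨ B.∙-cong B.refl (B.comm _ _) ⟩
      ι (base x) B.∙ (ι AC.⟪ α ∣ d ⟫ B.∙ BC.⟪ b ∣ coeffs y ⟫)       ≈⟨ B.sym (B.assoc _ _ _) ⟩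
      (ι (base x) B.∙ ι AC.⟪ α ∣ d ⟫) B.∙ BC.⟪ b ∣ coeffs y ⟫       ≈⟨ B.∙-cong (B.sym (ι.∙-homo _ _)) B.refl ⟩
      ι (base x A.∙ AC.⟪ α ∣ d ⟫) B.∙ BC.⟪ b ∣ coeffs y ⟫           ≈⟨ B.∙-cong (ι.⟦⟧-cong (A.sym q)) B.refl ⟩
      ι (base y) B.∙ BC.⟪ b ∣ coeffs y ⟫                            ∎
      where open SetoidReasoning B.setoid

    Φ-homo : ∀ x y → Φ (x +ᴾ y) B.≈ Φ x B.∙ Φ y
    Φ-homo x y = B.trans (B.∙-cong (ι.∙-homo _ _) (BC.⟪⟫-⊕ b (coeffs x) (coeffs y))) (BP.interchange _ _ _ _)

    Φ≈ε⇒~0 : ∀ x → Φ x B.≈ B.ε → x ~ 0ᴾ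
    Φ≈ε⇒~0 x Φx≈ε = rel (coeffs x ÷M)
      (λ j → Eq.trans (⟪b⟫≈ι⇒M∣ (coeffs x) (base x A.⁻¹) ⟪b⟫≈ι j) (Eq.sym (ℤP.+-identityˡ _)))
      (A.sym (A.trans (A.∙-cong A.refl (A.sym (⟪b⟫≈ι⇒≈⟪α⟫ (coeffs x) (base x A.⁻¹) ⟪b⟫≈ι))) (A.inverseʳ _)))
      where
        ⟪b⟫≈ι : BC.⟪ b ∣ coeffs x ⟫ B.≈ ι (base x A.⁻¹)
        ⟪b⟫≈ι = begin
          BC.⟪ b ∣ coeffs x ⟫                                    ≈⟨ B.sym (B.identityˡ _) ⟩
          B.ε B.∙ BC.⟪ b ∣ coeffs x ⟫                            ≈⟨ B.∙-cong (B.sym (B.inverseˡ (ι (base x)))) B.refl ⟩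
          (ι (base x) B.⁻¹ B.∙ ι (base x)) B.∙ BC.⟪ b ∣ coeffs x ⟫ ≈⟨ B.assoc _ _ _ ⟩
          ι (base x) B.⁻¹ B.∙ Φ x                               ≈⟨ B.∙-cong B.refl Φx≈ε ⟩
          ι (base x) B.⁻¹ B.∙ B.ε                               ≈⟨ B.identityʳ _ ⟩
          ι (base x) B.⁻¹                                       ≈⟨ B.sym (ιH.h-⁻¹ _) ⟩
          ι (base x A.⁻¹)                                       ∎
          where open SetoidReasoning B.setoid

    Φ-injective : ∀ {x y} → Φ x B.≈ Φ y → x ~ y
    Φ-injective {x} {y} Φx≈Φy = Powers.x∙y⁻¹≈ε⇒x≈y Presented x y (Φ≈ε⇒~0 (x +ᴾ -ᴾ y) (begin
      Φ (x +ᴾ -ᴾ y)         ≈⟨ Φ-homo x (-ᴾ y) ⟩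
      Φ x B.∙ Φ (-ᴾ y)      ≈⟨ B.∙-cong Φx≈Φy (B.trans (B.∙-cong (ιH.h-⁻¹ _) (BC.⟪⟫-⊝ b (coeffs y))) (BP.⁻¹-∙-comm _ _)) ⟩
      Φ y B.∙ Φ y B.⁻¹      ≈⟨ B.inverseʳ _ ⟩
      B.ε                   ∎))
      where open SetoidReasoning B.setoid

    Φ-section : ∀ y → Σ Elt λ x → Φ x B.≈ y
    Φ-section y = elt a c , (begin
      ι a B.∙ BC.⟪ b ∣ c ⟫                                    ≈⟨ B.∙-cong ι-a≈rest B.refl ⟩
      (y B.∙ BC.⟪ b ∣ c ⟫ B.⁻¹) B.∙ BC.⟪ b ∣ c ⟫             ≈⟨ B.assoc _ _ _ ⟩
      y B.∙ (BC.⟪ b ∣ c ⟫ B.⁻¹ B.∙ BC.⟪ b ∣ c ⟫)             ≈⟨ B.∙-cong B.refl (B.inverseˡ _) ⟩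
      y B.∙ B.ε                                               ≈⟨ B.identityʳ _ ⟩
      y                                                       ∎)
      where
        open SetoidReasoning B.setoid
        c : FinSupp
        c = coefficients (π y)
        π⟪b∣c⟫≈πy : π BC.⟪ b ∣ c ⟫ D.≈ π y
        π⟪b∣c⟫≈πy j = C.trans j (π⟪b⟫≈toSum c j) (toSum-coefficients (π y) j)
        π-rest≈ε : π (y B.∙ BC.⟪ b ∣ c ⟫ B.⁻¹) D.≈ D.ε
        π-rest≈ε j = C.trans j (π.homo y _ j)
          (C.trans j (C.∙-cong j (C.refl j) (C.trans j (πH.h-⁻¹ _ j) (C.⁻¹-cong j (π⟪b∣c⟫≈πy j))))
                     (C.inverseʳ j _))
        a : A.Carrier
        a = proj₁ (proj₁ (exact (y B.∙ BC.⟪ b ∣ c ⟫ B.⁻¹)) π-rest≈ε)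
        ι-a≈rest : ι a B.≈ y B.∙ BC.⟪ b ∣ c ⟫ B.⁻¹
        ι-a≈rest = proj₂ (proj₁ (exact (y B.∙ BC.⟪ b ∣ c ⟫ B.⁻¹)) π-rest≈ε)

    Φ-bijective : BijectiveHom Presented B
    Φ-bijective = record
      { to = Φ ; cong = Φ-cong ; homo = Φ-homo ; injective = Φ-injective ; section = Φ-section }

    ι≈⟪b∣l^N⊛⟫ : ∀ {N} → K ≤ N → ∀ x → Σ FinSupp λ c → BC.⟪ b ∣ + (l ^ N) ⊛ c ⟫ B.≈ ι x
    ι≈⟪b∣l^N⊛⟫ {N} K≤N x = coeffs x₀ , (begin
      BC.⟪ b ∣ + (l ^ N) ⊛ coeffs x₀ ⟫                                ≈⟨ BC.⟪⟫-⊛ b (+ (l ^ N)) (coeffs x₀) ⟩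
      (l ^ N) BP.· BC.⟪ b ∣ coeffs x₀ ⟫                               ≈⟨ B.identityˡ _ ⟨
      B.ε B.∙ (l ^ N) BP.· BC.⟪ b ∣ coeffs x₀ ⟫                       ≈⟨ B.∙-cong ι-l^N·a≈ε B.refl ⟨
      ι ((l ^ N) AP.· base x₀) B.∙ (l ^ N) BP.· BC.⟪ b ∣ coeffs x₀ ⟫  ≈⟨ B.∙-cong (ιH.h-· (l ^ N) (base x₀)) B.refl ⟩
      (l ^ N) BP.· ι (base x₀) B.∙ (l ^ N) BP.· BC.⟪ b ∣ coeffs x₀ ⟫  ≈⟨ BP.·-distribˡ-∙ (l ^ N) _ _ ⟨
      (l ^ N) BP.· Φ x₀                                               ≈⟨ BP.·-cong (l ^ N) (proj₂ (Φ-section y)) ⟩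
      (l ^ N) BP.· y                                                  ≈⟨ proj₂ ιx-divisible ⟩
      ι x                                                             ∎)
      where
        open SetoidReasoning B.setoid
        ιx-divisible : ∃ λ y → (l ^ N) BP.· y B.≈ ι x
        ιx-divisible = proj₁ (divisible (ι x)) (x , B.refl) (l ^ N) (ℕP.m^n>0 l N)
        y : B.Carrier
        y = proj₁ ιx-divisible
        x₀ : Elt
        x₀ = proj₁ (Φ-section y)
        ι-l^N·a≈ε : ι ((l ^ N) AP.· base x₀) B.≈ B.ε
        ι-l^N·a≈ε = B.trans (ι.⟦⟧-cong (l^·A≈ε K≤N (base x₀))) ιH.h-ε

    ⟪b∣l^N⊛⟫≈ι⇒÷M : ∀ {N} c x → BC.⟪ b ∣ + (l ^ N) ⊛ c ⟫ B.≈ ι x →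
                    ∀ j → n j ≤ N → coeff ((+ (l ^ N) ⊛ c) ÷M) j ≡ coeff c j ℤ.* + (l ^ (N ∸ n j))
    ⟪b∣l^N⊛⟫≈ι⇒÷M {N} c x c↦x j n≤N = ℤP.*-cancelˡ-≡ (M j) _ _ {{l^-nonZero (n j)}} (begin
      M j ℤ.* coeff ((+ (l ^ N) ⊛ c) ÷M) j               ≡⟨ ⟪b⟫≈ι⇒M∣ (+ (l ^ N) ⊛ c) x c↦x j ⟨
      + (l ^ N) ℤ.* coeff c j                           ≡⟨ Eq.cong (λ m → + m ℤ.* coeff c j) (l^-split (n j) N n≤N) ⟩
      + (l ^ (N ∸ n j) * l ^ n j) ℤ.* coeff c j         ≡⟨ Eq.cong (ℤ._* coeff c j) (ℤP.pos-* (l ^ (N ∸ n j)) (l ^ n j)) ⟩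
      + (l ^ (N ∸ n j)) ℤ.* M j ℤ.* coeff c j           ≡⟨ reorder (+ (l ^ (N ∸ n j))) (M j) (coeff c j) ⟩
      M j ℤ.* (coeff c j ℤ.* + (l ^ (N ∸ n j)))         ∎)
      where
        open Eq.≡-Reasoning
        reorder : ∀ p q r → p ℤ.* q ℤ.* r ≡ q ℤ.* (r ℤ.* p)
        reorder = solve-∀

    -- With ι x = ⟪ b ∣ l ^ (k + K) ⊛ c ⟫, x = ⟪ α ∣ d ⟫ where d j = c j · l ^ (k + K − n j);
    -- for n j < k this is a multiple of l ^ K, so the term vanishes.
    α-tails-span : TailsSpan α
    α-tails-span k x = proj₁ shortened , proj₁ (proj₂ shortened)
                      , A.trans (⟪b⟫≈ι⇒≈⟪α⟫ (+ (l ^ (k + K)) ⊛ c) x c↦x) (proj₂ (proj₂ shortened))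
      where
        c : FinSupp
        c = proj₁ (ι≈⟪b∣l^N⊛⟫ (ℕP.m≤n+m K k) x)
        c↦x : BC.⟪ b ∣ + (l ^ (k + K)) ⊛ c ⟫ B.≈ ι x
        c↦x = proj₂ (ι≈⟪b∣l^N⊛⟫ (ℕP.m≤n+m K k) x)
        d : FinSupp
        d = (+ (l ^ (k + K)) ⊛ c) ÷M
        small-vanish : ∀ j → n j < k → coeff d j AP.·ℤ α j A.≈ A.ε
        small-vanish j n<k = Eq.subst (λ z → z AP.·ℤ α j A.≈ A.ε)
          (Eq.sym (⟪b∣l^N⊛⟫≈ι⇒÷M c x c↦x j (ℕP.≤-trans (ℕP.<⇒≤ n<k) (ℕP.m≤m+n k K))))
          (l^·ℤA≈ε (ℕP.≤-trans (ℕP.m≤n+m K (k ∸ n j)) (ℕP.≤-reflexive (Eq.sym (ℕP.+-∸-comm K (ℕP.<⇒≤ n<k)))))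
                   (coeff c j) (α j))
        shortened : Σ FinSupp λ e → (∀ j → ¬ (coeff e j ≡ 0ℤ) → k ≤ n j) × (AC.⟪ α ∣ d ⟫ A.≈ AC.⟪ α ∣ e ⟫)
        shortened = drop-small k α d small-vanish

  private
    module P γ = Presentation A Level.zero (λ i → l ^ n i) γ

  TailsSpanOn : (ℕ → Bool) → (ℕ → A.Carrier) → Set (α₁ ⊔ α₂)
  TailsSpanOn T γ = ∀ k x → Σ FinSupp λ e →
    (∀ j → ¬ (coeff e j ≡ 0ℤ) → (k ≤ n j) × (T j ≡ true)) × (x A.≈ AC.⟪ γ ∣ e ⟫)

  -- If γ vanishes off T and γ′ agrees with γ on T, each γ′ i with i ∉ T is a
  -- combination of γ j with j ∈ T and n i ≤ n j; these define an admissible change of relations.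
  module Exchange (T : ℕ → Bool) (γ γ′ : ℕ → A.Carrier) (γ-off : ∀ i → T i ≡ false → γ i A.≈ A.ε)
                (agree : ∀ i → T i ≡ true → γ′ i A.≈ γ i) (span : TailsSpanOn T γ) where

    E-by : ∀ i → Bool → FinSupp
    E-by i true  = 0ᶠ
    E-by i false = proj₁ (span (n i) (γ′ i))

    E : ℕ → FinSupp
    E i = E-by i (T i)

    E-support : ∀ i j → ¬ (coeff (E i) j ≡ 0ℤ) → (n i ≤ n j) × (T j ≡ true)
    E-support i j E≢0 with T i
    ... | true  = ⊥-elim (E≢0 Eq.refl)
    ... | false = proj₁ (proj₂ (span (n i) (γ′ i))) j E≢0

    r : ℕ → FinSupp
    r i = mkFinSupp (λ j → coeff (E i) j ℤ.* + (l ^ (n j ∸ n i))) (bd (E i))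
      (λ j bd≤j → Eq.cong (ℤ._* + (l ^ (n j ∸ n i))) (beyond-bd (E i) j bd≤j))

    m·r≡m·E : ∀ i j → + (l ^ n i) ℤ.* coeff (r i) j ≡ + (l ^ n j) ℤ.* coeff (E i) j
    m·r≡m·E i j with coeff (E i) j ℤ.≟ 0ℤ
    ... | yes E≡0 rewrite E≡0 = Eq.trans (Eq.cong (+ (l ^ n i) ℤ.*_) (ℤP.*-zeroˡ (+ (l ^ (n j ∸ n i)))))
                                         (Eq.trans (ℤP.*-zeroʳ (+ (l ^ n i))) (Eq.sym (ℤP.*-zeroʳ (+ (l ^ n j)))))
    ... | no  E≢0 = begin
      + (l ^ n i) ℤ.* (coeff (E i) j ℤ.* + (l ^ (n j ∸ n i)))  ≡⟨ reorder (+ (l ^ n i)) (coeff (E i) j) (+ (l ^ (n j ∸ n i))) ⟩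
      + (l ^ (n j ∸ n i)) ℤ.* + (l ^ n i) ℤ.* coeff (E i) j    ≡⟨ Eq.cong (ℤ._* coeff (E i) j) (ℤP.pos-* (l ^ (n j ∸ n i)) (l ^ n i)) ⟨
      + (l ^ (n j ∸ n i) * l ^ n i) ℤ.* coeff (E i) j          ≡⟨ Eq.cong (λ k → + k ℤ.* coeff (E i) j) (l^-split (n i) (n j) (proj₁ (E-support i j E≢0))) ⟨
      + (l ^ n j) ℤ.* coeff (E i) j                            ∎
      where
        open Eq.≡-Reasoning
        reorder : ∀ p e q → p ℤ.* (e ℤ.* q) ≡ q ℤ.* p ℤ.* e
        reorder = solve-∀

    γ′≈γ+⟪γ∣E⟫ : ∀ i → γ′ i A.≈ γ i A.∙ AC.⟪ γ ∣ E i ⟫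
    γ′≈γ+⟪γ∣E⟫ i with T i in T≡
    ... | true  = A.trans (agree i T≡) (A.sym (A.identityʳ _))
    ... | false = A.trans (proj₂ (proj₂ (span (n i) (γ′ i))))
                          (A.trans (A.sym (A.identityˡ _)) (A.∙-cong (A.sym (γ-off i T≡)) A.refl))

    ⟪γ′∣E⟫≈⟪γ∣E⟫ : ∀ i → AC.⟪ γ′ ∣ E i ⟫ A.≈ AC.⟪ γ ∣ E i ⟫
    ⟪γ′∣E⟫≈⟪γ∣E⟫ i = AP.∑<-cong (bd (E i)) term
      where
        term : ∀ j → coeff (E i) j AP.·ℤ γ′ j A.≈ coeff (E i) j AP.·ℤ γ j
        term j with coeff (E i) j ℤ.≟ 0ℤ
        ... | yes E≡0 = A.trans (AC.·ℤ-0 (γ′ j) E≡0) (A.sym (AC.·ℤ-0 (γ j) E≡0))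
        ... | no  E≢0 = AP.·ℤ-cong (coeff (E i) j) (agree j (proj₂ (E-support i j E≢0)))

    r-zero : RowOrColumnZero r
    r-zero i with T i in T≡
    ... | true  = inj₁ (λ j → ℤP.*-zeroˡ (+ (l ^ (n j ∸ n i))))
    ... | false = inj₂ column-zero
      where
        column-zero : ∀ k → coeff (r k) i ≡ 0ℤ
        column-zero k with coeff (E k) i ℤ.≟ 0ℤ
        ... | yes E≡0 = Eq.cong (ℤ._* + (l ^ (n i ∸ n k))) E≡0
        ... | no  E≢0 with Eq.trans (Eq.sym T≡) (proj₂ (E-support k i E≢0))
        ... | ()

    bijective : BijectiveHom (P.Presented γ′) (P.Presented γ)
    bijective = relationChange-bijective A Level.zero (λ i → l ^ n i) γ′ γ r E r-zero m·r≡m·E γ′≈γ+⟪γ∣E⟫ ⟪γ′∣E⟫≈⟪γ∣E⟫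

  restrict : (ℕ → Bool) → (ℕ → A.Carrier) → ℕ → A.Carrier
  restrict T γ i = if T i then γ i else A.ε

  restrict-off : ∀ T γ i → T i ≡ false → restrict T γ i A.≈ A.ε
  restrict-off T γ i T≡ rewrite T≡ = A.refl

  restrict-on : ∀ T γ i → T i ≡ true → γ i A.≈ restrict T γ i
  restrict-on T γ i T≡ rewrite T≡ = A.refl

  ⟪restrict⟫ : ∀ T γ e → (∀ j → ¬ (coeff e j ≡ 0ℤ) → T j ≡ true) → AC.⟪ γ ∣ e ⟫ A.≈ AC.⟪ restrict T γ ∣ e ⟫
  ⟪restrict⟫ T γ e supported = AP.∑<-cong (bd e) term
    where
      term : ∀ j → coeff e j AP.·ℤ γ j A.≈ coeff e j AP.·ℤ restrict T γ j
      term j with coeff e j ℤ.≟ 0ℤ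
      ... | yes e≡0 = A.trans (AC.·ℤ-0 (γ j) e≡0) (A.sym (AC.·ℤ-0 (restrict T γ j) e≡0))
      ... | no  e≢0 = AP.·ℤ-cong (coeff e j) (restrict-on T γ j (supported j e≢0))

  -- Back and forth: the exponents are cut into consecutive stages; in even stages every element
  -- of A is spanned by α, in odd stages by β.  With T = indices in even stages, α is exchanged
  -- for α on T, then for the mixture of α on T and β off T, and finally for β.
  module Interleaving (α β : ℕ → A.Carrier) (α-span : TailsSpan α) (β-span : TailsSpan β) where

    spanning : Bool → ℕ → A.Carrier → FinSupp
    spanning true  k x = proj₁ (α-span k x)
    spanning false k x = proj₁ (β-span k x)

    boundary : ℕ → ℕ
    boundary zero    = 0
    boundary (suc r) = suc (boundary r ⊔ℕ
      maxFin A-size (λ t → max< (bd (spanning (even r) (boundary r) (A-enum t))) n))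

    stageVector : ℕ → Fin A-size → FinSupp
    stageVector r t = spanning (even r) (boundary r) (A-enum t)

    boundary-< : ∀ r → boundary r < boundary (suc r)
    boundary-< r = s≤s (ℕP.m≤m⊔n _ _)

    boundary-mono : ∀ {r r′} → r ≤ r′ → boundary r ≤ boundary r′
    boundary-mono {r} {r′} r≤r′ with ℕP.m≤n⇒m<n∨m≡n r≤r′
    ... | inj₂ Eq.refl   = ℕP.≤-refl
    ... | inj₁ (s≤s r<r′) = ℕP.≤-trans (boundary-mono r<r′) (ℕP.<⇒≤ (boundary-< _))

    ≤-boundary : ∀ r → r ≤ boundary r
    ≤-boundary zero    = z≤n
    ≤-boundary (suc r) = ℕP.≤-trans (s≤s (≤-boundary r)) (boundary-< r)

    stageVector-support : ∀ r t j → ¬ (coeff (stageVector r t) j ≡ 0ℤ) →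
                          (boundary r ≤ n j) × (n j < boundary (suc r))
    stageVector-support r t j e≢0 = lower , upper
      where
        lower : boundary r ≤ n j
        lower with even r
        ... | true  = proj₁ (proj₂ (α-span (boundary r) (A-enum t))) j e≢0
        ... | false = proj₁ (proj₂ (β-span (boundary r) (A-enum t))) j e≢0
        upper : n j < boundary (suc r)
        upper = s≤s (ℕP.≤-trans (≤-max< (bd (stageVector r t)) n j (nonzero⇒<bd (stageVector r t) j e≢0))
          (ℕP.≤-trans (≤-maxFin A-size (λ t → max< (bd (stageVector r t)) n) t) (ℕP.m≤n⊔m _ _)))

    stageVector-even : ∀ r t → even r ≡ true → A-enum t A.≈ AC.⟪ α ∣ stageVector r t ⟫
    stageVector-even r t even-r with even r
    stageVector-even r t Eq.refl | true = proj₂ (proj₂ (α-span (boundary r) (A-enum t)))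

    stageVector-odd : ∀ r t → even r ≡ false → A-enum t A.≈ AC.⟪ β ∣ stageVector r t ⟫
    stageVector-odd r t odd-r with even r
    stageVector-odd r t Eq.refl | false = proj₂ (proj₂ (β-span (boundary r) (A-enum t)))

    stage-search : ℕ → ℕ → ℕ
    stage-search x zero    = zero
    stage-search x (suc r) with boundary (suc r) ℕ.≤? x
    ... | yes _ = suc r
    ... | no  _ = stage-search x r

    stage-search-spec : ∀ x r → x < boundary (suc r) →
      (boundary (stage-search x r) ≤ x) × (x < boundary (suc (stage-search x r)))
    stage-search-spec x zero    x<b = z≤n , x<b
    stage-search-spec x (suc r) x<b with boundary (suc r) ℕ.≤? x
    ... | yes b≤x = b≤x , x<b
    ... | no  b≰x = stage-search-spec x r (ℕP.≰⇒> b≰x)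

    stage : ℕ → ℕ
    stage x = stage-search x x

    stage-spec : ∀ x → (boundary (stage x) ≤ x) × (x < boundary (suc (stage x)))
    stage-spec x = stage-search-spec x x (ℕP.<-≤-trans (s≤s ℕP.≤-refl) (≤-boundary (suc x)))

    stage-unique : ∀ x r → boundary r ≤ x → x < boundary (suc r) → stage x ≡ r
    stage-unique x r b≤x x<b with ℕP.<-cmp (stage x) r
    ... | tri≈ _ eq _ = eq
    ... | tri< lt _ _ = ⊥-elim (ℕP.<⇒≱ (proj₂ (stage-spec x)) (ℕP.≤-trans (boundary-mono lt) b≤x))
    ... | tri> _ _ gt = ⊥-elim (ℕP.<⇒≱ x<b (ℕP.≤-trans (boundary-mono gt) (proj₁ (stage-spec x))))

    T : ℕ → Bool
    T j = even (stage (n j))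

    T′ : ℕ → Bool
    T′ j = not (T j)

    stageVector-T : ∀ r t j → ¬ (coeff (stageVector r t) j ≡ 0ℤ) → T j ≡ even r
    stageVector-T r t j e≢0 = Eq.cong even
      (stage-unique (n j) r (proj₁ (stageVector-support r t j e≢0)) (proj₂ (stageVector-support r t j e≢0)))

    α-span-on-T : TailsSpanOn T (restrict T α)
    α-span-on-T k x = e , support ,
      A.trans (A.sym (proj₂ (A-enum-surj x)))
              (A.trans (stageVector-even r t (even-double k)) (⟪restrict⟫ T α e (λ j e≢0 → proj₂ (support j e≢0))))
      where
        r : ℕ
        r = double k
        t : Fin A-size
        t = proj₁ (A-enum-surj x)
        e : FinSupp
        e = stageVector r t
        support : ∀ j → ¬ (coeff e j ≡ 0ℤ) → (k ≤ n j) × (T j ≡ true)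
        support j e≢0 = ℕP.≤-trans (≤-double k) (ℕP.≤-trans (≤-boundary r) (proj₁ (stageVector-support r t j e≢0)))
                      , Eq.trans (stageVector-T r t j e≢0) (even-double k)

    β-span-on-T′ : TailsSpanOn T′ (restrict T′ β)
    β-span-on-T′ k x = e , support ,
      A.trans (A.sym (proj₂ (A-enum-surj x)))
              (A.trans (stageVector-odd r t (even-suc-double k)) (⟪restrict⟫ T′ β e (λ j e≢0 → proj₂ (support j e≢0))))
      where
        r : ℕ
        r = suc (double k)
        t : Fin A-size
        t = proj₁ (A-enum-surj x)
        e : FinSupp
        e = stageVector r t
        support : ∀ j → ¬ (coeff e j ≡ 0ℤ) → (k ≤ n j) × (T′ j ≡ true)
        support j e≢0 = ℕP.≤-trans (≤-double k) (ℕP.≤-trans (≤-boundary (double k))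
                          (ℕP.≤-trans (boundary-mono (ℕP.n≤1+n (double k))) (proj₁ (stageVector-support r t j e≢0))))
                      , Eq.cong not (Eq.trans (stageVector-T r t j e≢0) (even-suc-double k))

    mixture : ℕ → A.Carrier
    mixture i = if T i then α i else β i

    presented-iso : BijectiveHom (P.Presented α) (P.Presented β)
    presented-iso = inverse β→β′ ∘ᵇ mix→β′ ∘ᵇ inverse mix→α′ ∘ᵇ α→α′
      where
        α→α′ : BijectiveHom (P.Presented α) (P.Presented (restrict T α))
        α→α′ = Exchange.bijective T (restrict T α) α (restrict-off T α) (λ i T≡ → restrict-on T α i T≡) α-span-on-T
        mix→α′ : BijectiveHom (P.Presented mixture) (P.Presented (restrict T α))
        mix→α′ = Exchange.bijective T (restrict T α) mixture (restrict-off T α) mixture-on-T α-span-on-T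
          where
            mixture-on-T : ∀ i → T i ≡ true → mixture i A.≈ restrict T α i
            mixture-on-T i T≡ rewrite T≡ = A.refl
        mix→β′ : BijectiveHom (P.Presented mixture) (P.Presented (restrict T′ β))
        mix→β′ = Exchange.bijective T′ (restrict T′ β) mixture (restrict-off T′ β) mixture-on-T′ β-span-on-T′
          where
            mixture-on-T′ : ∀ i → T′ i ≡ true → mixture i A.≈ restrict T′ β i
            mixture-on-T′ i T′≡ with T i
            mixture-on-T′ i Eq.refl | false = A.refl
        β→β′ : BijectiveHom (P.Presented β) (P.Presented (restrict T′ β))
        β→β′ = Exchange.bijective T′ (restrict T′ β) β (restrict-off T′ β) (λ i T′≡ → restrict-on T′ β i T′≡) β-span-on-T′

  module Existence where
    index : ℕ → ℕ
    index zero    = proj₁ (n-unbounded 0)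
    index (suc s) = proj₁ (n-unbounded (suc (n (index s))))

    n-index-< : ∀ s → n (index s) < n (index (suc s))
    n-index-< s = proj₂ (n-unbounded (suc (n (index s))))

    ≤-n-index : ∀ s → s ≤ n (index s)
    ≤-n-index zero    = z≤n
    ≤-n-index (suc s) = ℕP.≤-trans (s≤s (≤-n-index s)) (n-index-< s)

    n-index-strictMono : ∀ {s s′} → s < s′ → n (index s) < n (index s′)
    n-index-strictMono {s} {suc s′} (s≤s s≤s′) with ℕP.m≤n⇒m<n∨m≡n s≤s′
    ... | inj₁ s<s′    = ℕP.<-trans (n-index-strictMono s<s′) (n-index-< s′)
    ... | inj₂ Eq.refl = n-index-< s

    index-injective : ∀ {s s′} → index s ≡ index s′ → s ≡ s′
    index-injective {s} {s′} eq with ℕP.<-cmp s s′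
    ... | tri< s<s′ _ _ = ⊥-elim (ℕP.<-irrefl (Eq.cong n eq) (n-index-strictMono s<s′))
    ... | tri≈ _ s≡s′ _ = s≡s′
    ... | tri> _ _ s>s′ = ⊥-elim (ℕP.<-irrefl (Eq.cong n (Eq.sym eq)) (n-index-strictMono s>s′))

    instance
      A-size-nonZero : NonZero A-size
      A-size-nonZero = FinP.nonZeroIndex (proj₁ (A-enum-surj A.ε))

    label : ℕ → Fin A-size
    label s = fromℕ< (m%n<n s A-size)

    -- α₀ runs through the elements of A along the indices index 0, index 1, …, so every
    -- element of A is hit at indices with arbitrarily large exponent.
    α₀ : ℕ → A.Carrier
    α₀ i with ℕP.anyUpTo? (λ s → index s ℕ.≟ i) (suc (n i))
    ... | yes (s , _ , _) = A-enum (label s)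
    ... | no  _           = A.ε

    α₀-index : ∀ s → α₀ (index s) A.≈ A-enum (label s)
    α₀-index s with ℕP.anyUpTo? (λ s′ → index s′ ℕ.≟ index s) (suc (n (index s)))
    ... | yes (s′ , _ , eq) = A.reflexive (Eq.cong (λ s → A-enum (label s)) (index-injective eq))
    ... | no  none          = ⊥-elim (none (s , s≤s (≤-n-index s) , Eq.refl))

    α₀-surjective-beyond : ∀ E x → ∃ λ j → (E ≤ n j) × (α₀ j A.≈ x)
    α₀-surjective-beyond E x = index s , E≤n ,
      A.trans (α₀-index s) (Eq.subst (λ t → A-enum t A.≈ x) (Eq.sym label-s) (proj₂ (A-enum-surj x)))
      where
        t : Fin A-size
        t = proj₁ (A-enum-surj x)
        s : ℕ
        s = toℕ t + E * A-size
        label-s : label s ≡ t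
        label-s = FinP.toℕ-injective (Eq.trans (FinP.toℕ-fromℕ< (m%n<n s A-size))
          (Eq.trans ([m+kn]%n≡m%n (toℕ t) E A-size) (m<n⇒m%n≡m (FinP.toℕ<n t))))
        E≤n : E ≤ n (index s)
        E≤n = ℕP.≤-trans (ℕP.m≤m*n E A-size) (ℕP.≤-trans (ℕP.m≤n+m (E * A-size) (toℕ t)) (≤-n-index s))

    open Presentation A (α₁ ⊔ α₂ ⊔ γ₁ ⊔ γ₂) (λ i → l ^ n i) α₀ public

    private
      module PP = Powers Presented

    π₀ : Elt → D.Carrier
    π₀ x = toSum (coeffs x)

    π₀-cong : ∀ {x y} → x ~ y → π₀ x D.≈ π₀ y
    π₀-cong {x} {y} (rel′ d c≡c′+Md _ _) = toSum-cong {coeffs x} {coeffs y} d c≡c′+Md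

    π₀-homo : ∀ x y → π₀ (x +ᴾ y) D.≈ π₀ x D.∙ π₀ y
    π₀-homo x y = toSum-⊕ (coeffs x) (coeffs y)

    private
      module π₀H = HomomorphismProperties Presented (⨁ C) π₀ π₀-cong π₀-homo
      module ιH = HomomorphismProperties A Presented ι ι-cong ι-homo

    π₀-surjective : ∀ y → ∃ λ x → ∀ {z} → z ~ x → π₀ z D.≈ y
    π₀-surjective y = elt A.ε (coefficients y) ,
      λ {z} z~x → D.trans {π₀ z} {π₀ (elt A.ε (coefficients y))} {y} (π₀-cong z~x) (toSum-coefficients y)

    π₀≈ε⇒∈ι : ∀ x → π₀ x D.≈ D.ε → ∃ λ y → ι y ~ x
    π₀≈ε⇒∈ι x π₀x≈ε = base x A.∙ AC.⟪ α₀ ∣ q ⟫ , rel (⊝ q) coefficients-eq (A.sym (begin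
      (base x A.∙ AC.⟪ α₀ ∣ q ⟫) A.∙ AC.⟪ α₀ ∣ ⊝ q ⟫           ≈⟨ A.∙-cong A.refl (AC.⟪⟫-⊝ α₀ q) ⟩
      (base x A.∙ AC.⟪ α₀ ∣ q ⟫) A.∙ AC.⟪ α₀ ∣ q ⟫ A.⁻¹       ≈⟨ A.assoc _ _ _ ⟩
      base x A.∙ (AC.⟪ α₀ ∣ q ⟫ A.∙ AC.⟪ α₀ ∣ q ⟫ A.⁻¹)       ≈⟨ A.∙-cong A.refl (A.inverseʳ _) ⟩
      base x A.∙ A.ε                                          ≈⟨ A.identityʳ _ ⟩
      base x                                                  ∎))
      where
        open SetoidReasoning A.setoid
        q : FinSupp
        q = coeffs x ÷M
        coefficients-eq : ∀ j → 0ℤ ≡ coeff (coeffs x) j ℤ.+ M j ℤ.* ℤ.- coeff q j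
        coefficients-eq j = Eq.trans (cancel (M j) (coeff q j))
          (Eq.cong (λ w → w ℤ.+ M j ℤ.* ℤ.- coeff q j) (Eq.sym (÷M-correct (coeffs x) (toSum≈ε⇒l^n∣ (coeffs x) π₀x≈ε) j)))
          where
            cancel : ∀ k q → 0ℤ ≡ k ℤ.* q ℤ.+ k ℤ.* ℤ.- q
            cancel = solve-∀

    ∈ι⇒π₀≈ε : ∀ x → (∃ λ y → ι y ~ x) → π₀ x D.≈ D.ε
    ∈ι⇒π₀≈ε x (y , ιy~x) = D.sym {π₀ (ι y)} {π₀ x} (π₀-cong ιy~x)

    l-torsion : IsTorsionLGroup Presented l
    l-torsion x = k , ~-trans (·-elt (l ^ k) x) (rel d coefficients-eq base-eq)
      where
        k : ℕ
        k = K + max< (bd (coeffs x)) n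
        d : FinSupp
        d = proj₁ (l^⊛≡⊙M (coeffs x))
        coefficients-eq : ∀ j → + (l ^ k) ℤ.* coeff (coeffs x) j ≡ 0ℤ ℤ.+ M j ℤ.* coeff d j
        coefficients-eq j = Eq.trans (proj₁ (proj₂ (l^⊛≡⊙M (coeffs x))) j) (Eq.sym (ℤP.+-identityˡ _))
        base-eq : A.ε A.≈ (l ^ k) AP.· base x A.∙ AC.⟪ α₀ ∣ d ⟫
        base-eq = A.sym (A.trans (A.∙-cong (l^·A≈ε (ℕP.m≤m+n K _) (base x)) (proj₂ (proj₂ (l^⊛≡⊙M (coeffs x))) α₀))
                                 (A.identityˡ _))

    -- x = α₀ j for some j with n j ≥ k + K; if k w = l ^ n j (1 + u l ^ K′) then k · (w e j) = x.
    ι-divisible : ∀ x k → 1 ≤ k → ∃ λ y → (k PP.· y) ~ ι x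
    ι-divisible x k 1≤k = y , ~-trans (·-elt k y) (rel (single j q) coefficients-eq base-eq)
      where
        j : ℕ
        j = proj₁ (α₀-surjective-beyond (k + K) x)
        bezout : ∃ λ w → ∃ λ u → ∃ λ K′ → (K ≤ K′) × (+ k ℤ.* w ≡ + (l ^ n j) ℤ.* (+ 1 ℤ.+ u ℤ.* + (l ^ K′)))
        bezout = ∣l^N*[1+u*l^K′] k K (n j) 1≤k (proj₁ (proj₂ (α₀-surjective-beyond (k + K) x)))
        w u : ℤ
        w = proj₁ bezout
        u = proj₁ (proj₂ bezout)
        K′ : ℕ
        K′ = proj₁ (proj₂ (proj₂ bezout))
        K≤K′ : K ≤ K′
        K≤K′ = proj₁ (proj₂ (proj₂ (proj₂ bezout)))
        q : ℤ
        q = + 1 ℤ.+ u ℤ.* + (l ^ K′)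
        y : Elt
        y = elt A.ε (single j w)
        coefficients-eq : ∀ i → + k ℤ.* δ j w i ≡ 0ℤ ℤ.+ M i ℤ.* δ j q i
        coefficients-eq i with i ℕ.≟ j
        ... | yes Eq.refl = Eq.trans (proj₂ (proj₂ (proj₂ (proj₂ bezout)))) (Eq.sym (ℤP.+-identityˡ _))
        ... | no  _       = Eq.trans (ℤP.*-zeroʳ (+ k)) (Eq.sym (Eq.trans (ℤP.+-identityˡ _) (ℤP.*-zeroʳ (M i))))
        base-eq : x A.≈ k AP.· A.ε A.∙ AC.⟪ α₀ ∣ single j q ⟫
        base-eq = A.sym (begin
          k AP.· A.ε A.∙ AC.⟪ α₀ ∣ single j q ⟫             ≈⟨ A.∙-cong (AP.·-ε k) (AC.⟪⟫-single α₀ j q) ⟩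
          A.ε A.∙ q AP.·ℤ α₀ j                              ≈⟨ A.identityˡ _ ⟩
          q AP.·ℤ α₀ j                                      ≈⟨ AP.·ℤ-distribʳ-+ (+ 1) (u ℤ.* + (l ^ K′)) (α₀ j) ⟩
          (+ 1) AP.·ℤ α₀ j A.∙ (u ℤ.* + (l ^ K′)) AP.·ℤ α₀ j ≈⟨ A.∙-cong (AP.·ℤ-identityˡ (α₀ j)) (l^·ℤA≈ε K≤K′ u (α₀ j)) ⟩
          α₀ j A.∙ A.ε                                      ≈⟨ A.identityʳ _ ⟩
          α₀ j                                              ≈⟨ proj₂ (proj₂ (α₀-surjective-beyond (k + K) x)) ⟩
          x                                                 ∎)
          where open SetoidReasoning A.setoid

    -- l ^ N · y = x with N ≥ every n j in the support of x forces π₀ x = l ^ N · π₀ y = 0.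
    divisible⇒∈ι : ∀ x → IsDivisibleElt Presented x → ∃ λ y → ι y ~ x
    divisible⇒∈ι x divisible = π₀≈ε⇒∈ι x coordinate≈ε
      where
        c : FinSupp
        c = coeffs x
        N : ℕ
        N = max< (bd c) n
        y : Elt
        y = proj₁ (divisible (l ^ N) (ℕP.m^n>0 l N))
        l^N·y~x : (l ^ N) PP.· y ~ x
        l^N·y~x = proj₂ (divisible (l ^ N) (ℕP.m^n>0 l N))
        coordinate≈ε : ∀ j → C._≈_ j (CP._·ℤ_ j (coeff c j) (g j)) (C.ε j)
        coordinate≈ε j with j ℕ.<? bd c
        ... | yes j<bd = C.trans j (C.sym j (π₀-cong l^N·y~x j)) (C.trans j (π₀H.h-· (l ^ N) y j)
              (C.trans j (coord-· (l ^ N) (π₀ y) j) (C.trans j (C.sym j (CP.·ℤ-comm-· j (coeff (coeffs y) j) (l ^ N) (g j)))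
              (C.trans j (CP.·ℤ-cong j (coeff (coeffs y) j) (l^n·g≈ε j (≤-max< (bd c) n j j<bd))) (CP.·ℤ-ε j (coeff (coeffs y) j))))))
        ... | no  j≮bd = Combination.·ℤ-0 (C j) (g j) (beyond-bd c j (ℕP.≮⇒≥ j≮bd))

    solution : IsSolution l A C Presented
    solution = record
      { torsion-l = l-torsion
      ; ι         = ι
      ; π         = π₀
      ; ι-mono    = record { isGroupHomomorphism = ιH.isGroupHomomorphism
                           ; injective = ι-injective (λ i → l^-nonZero (n i)) }
      ; π-hom     = π₀H.isGroupHomomorphism
      ; π-surj    = π₀-surjective
      ; exact     = λ x → π₀≈ε⇒∈ι x , ∈ι⇒π₀≈ε x
      ; divisible = λ x → (λ { (y , ιy~x) k 1≤k → proj₁ (ι-divisible y k 1≤k) , ~-trans (proj₂ (ι-divisible y k 1≤k)) ιy~x })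
                        , divisible⇒∈ι x }

mainTheorem7 : ∀ {a ℓa c ℓc b₁ ℓ₁ b₂ ℓ₂ : Level}
    (l : ℕ) → Prime l →
    (C : ℕ → AbelianGroup c ℓc) →
    (∀ i → IsCyclic (C i)) →
    (∀ i → IsFinite (C i)) →
    (∀ i → IsTorsionLGroup (C i) l) →
    (∀ N → ∃ λ i → ∃ λ m → HasCard (C i) m × N < m) →
    (A : AbelianGroup a ℓa) →
    IsFinite A →
    IsTorsionLGroup A l →
    (Σ (AbelianGroup (a ⊔ ℓa ⊔ c ⊔ ℓc) (a ⊔ ℓa ⊔ c ⊔ ℓc)) λ B → IsSolution l A C B)
    × ((B₁ : AbelianGroup b₁ ℓ₁) (B₂ : AbelianGroup b₂ ℓ₂) →
    IsSolution l A C B₁ → IsSolution l A C B₂ → Isomorphic B₁ B₂)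
mainTheorem7 l l-prime C C-cyclic C-finite C-l-group C-unbounded A A-finite A-l-group =
  (Existence.Presented , Existence.solution) , unique
  where
    open Extensions l l-prime C C-cyclic C-finite C-l-group C-unbounded A A-finite A-l-group
    unique : ∀ {b₁ ℓ₁ b₂ ℓ₂} (B₁ : AbelianGroup b₁ ℓ₁) (B₂ : AbelianGroup b₂ ℓ₂) →
             IsSolution l A C B₁ → IsSolution l A C B₂ → Isomorphic B₁ B₂
    unique B₁ B₂ sol₁ sol₂ =
      bijectiveHom⇒isomorphic (S₂.Φ-bijective ∘ᵇ I.presented-iso ∘ᵇ inverse S₁.Φ-bijective)
      where
        module S₁ = SolutionIsPresented B₁ sol₁
        module S₂ = SolutionIsPresented B₂ sol₂
        module I = Interleaving S₁.α S₂.α S₁.α-tails-span S₂.α-tails-span
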